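{- Let $k\ge 5$ be an integer and let $\Gamma^{(k)}$ be the graph defined below. For every $j\in\mathbb{Z}_{4k+2}$ the following hold: (i) $S_2(y_j)=\big((\pm1+j+\langle 2k+1\rangle)\cup(j+\{2k-2,6k\}),\ (\pm2+j+\langle 2k+1\rangle)\cup\{j+2k+1\}\big)$; (ii) $S_3(y_j)=\big((\pm3+j-1+\langle 2k+1\rangle)\cup(-2+j+\langle 4k+2\rangle),\ (\pm3+j+\langle 2k+1\rangle)\cup(\pm1+j+\langle 2k+1\rangle)\big)$; (iii) $S_4(y_j)=\big((\pm4+j-1+\langle 2k+1\rangle)\cup(-3+j+\langle 4k+2\rangle),\ \pm4+j+\langle 2k+1\rangle\big)$; (iv) $S_i(y_j)=\big(\pm i+j-1+\langle 2k+1\rangle,\ \pm i+j+\langle 2k+1\rangle\big)$ for every $5\le i\le k$; (v) $|S_2(y_j)|=15$, $|S_3(y_j)|=18$, $|S_4(y_j)|=14$ and $|S_i(y_j)|=12$ for every $5\le i\le k$; moreover the eccentricity of $y_j$ equals $k$.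
   Context: $\Gamma^{(k)}$ is the graph on $12k+6$ vertices $\{x_i\mid i\in\mathbb{Z}_{8k+4}\}\cup\{y_i\mid i\in\mathbb{Z}_{4k+2}\}$ with edges $x_i\sim x_{i+1}$ ($i\in\mathbb{Z}_{8k+4}$) and $y_i\sim x_{i+m}$ for $m\in\{0,2k-1,2k+1,4k+2,6k+1,6k+3\}$ (indices of $x$ modulo $8k+4$, indices of $y$ modulo $4k+2$; independent of the integer representative of $i$). A subset $X$ of the vertex set is written as a pair $(A,B)$ with $A=\{i\in\mathbb{Z}_{8k+4}\mid x_i\in X\}$ and $B=\{i\in\mathbb{Z}_{4k+2}\mid y_i\in X\}$; first-coordinate expressions are computed in $\mathbb{Z}_{8k+4}$ (with $j$ taken as an integer representative) and second-coordinate expressions in $\mathbb{Z}_{4k+2}$. For $H\subseteq\mathbb{Z}_\ell$ and integer $j$, $j+H=\{j+h\mid h\in H\}$; $\pm a+H=(a+H)\cup(-a+H)$; $\langle h\rangle=\{nh\mid n\in\mathbb{Z}\}$ in the relevant $\mathbb{Z}_\ell$. $S_i(u)$ is the set of vertices at distance $i$ from $u$; the eccentricity of $u$ is the maximum distance from $u$ to a vertex. -}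

module Defs where

open import Level using (0ℓ)
open import Data.Nat as ℕ using (ℕ; zero; suc)
open import Data.Fin using (Fin; toℕ)
open import Data.Integer as ℤ using (ℤ; +_)
open import Data.Integer.Divisibility using (_∣_)
open import Data.List using (List; []; _∷_; length)
open import Data.List.Relation.Unary.Any using (Any)
open import Data.List.Relation.Unary.Unique.Propositional using (Unique)
open import Data.List.Membership.Propositional using (_∈_)
open import Data.Product using (Σ; ∃; _×_; _,_)
open import Data.Sum using (_⊎_)
open import Relation.Unary using (Pred; _∪_) public
open import Relation.Nullary using (¬_)
open import Relation.Binary.PropositionalEquality using (_≡_)
open import Function.Bundles using (_⇔_)

_≡_[mod_] : ℤ → ℤ → ℕ → Set
a ≡ b [mod L ] = (+ L) ∣ (a ℤ.- b)

-- Subsets of ℤ_L, represented as predicates on integer representatives.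
ZSet : Set₁
ZSet = Pred ℤ 0ℓ

⟨_⟩[_] : ℤ → ℕ → ZSet
⟨ h ⟩[ L ] a = ∃ λ (n : ℤ) → a ≡ n ℤ.* h [mod L ]

⟦_⟧[_] : List ℤ → ℕ → ZSet
⟦ cs ⟧[ L ] a = Any (λ c → a ≡ c [mod L ]) cs

infixr 6 _+ₛ_ ±_+ₛ_
_+ₛ_ : ℤ → ZSet → ZSet
(c +ₛ H) a = H (a ℤ.- c)

±_+ₛ_ : ℤ → ZSet → ZSet
± c +ₛ H = (c +ₛ H) ∪ (ℤ.- c +ₛ H)

Lx : ℕ → ℕ
Lx k = 8 ℕ.* k ℕ.+ 4

Ly : ℕ → ℕ
Ly k = 4 ℕ.* k ℕ.+ 2

kℤ : ℕ → ℤ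
kℤ k = + k

data V (k : ℕ) : Set where
  x : Fin (Lx k) → V k
  y : Fin (Ly k) → V k

offsets : ℕ → List ℤ
offsets k = + 0 ∷ (+ 2 ℤ.* + k ℤ.- + 1) ∷ (+ 2 ℤ.* + k ℤ.+ + 1)
          ∷ (+ 4 ℤ.* + k ℤ.+ + 2) ∷ (+ 6 ℤ.* + k ℤ.+ + 1) ∷ (+ 6 ℤ.* + k ℤ.+ + 3) ∷ []

data Edge (k : ℕ) : V k → V k → Set where
  xx : (a b : Fin (Lx k)) → (+ toℕ b) ≡ (+ toℕ a) ℤ.+ + 1 [mod Lx k ] → Edge k (x a) (x b)
  yx : (i : Fin (Ly k)) (a : Fin (Lx k)) →
       Any (λ m → (+ toℕ a) ≡ (+ toℕ i) ℤ.+ m [mod Lx k ]) (offsets k) → Edge k (y i) (x a)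

Adj : (k : ℕ) → V k → V k → Set
Adj k u v = Edge k u v ⊎ Edge k v u

data Walk (k : ℕ) : V k → V k → ℕ → Set where
  here : ∀ {u} → Walk k u u 0
  step : ∀ {u v w n} → Adj k u v → Walk k v w n → Walk k u w (suc n)

IsDist : (k : ℕ) → V k → V k → ℕ → Set
IsDist k u v d = Walk k u v d × (∀ m → m ℕ.< d → ¬ Walk k u v m)

S : (k : ℕ) → ℕ → V k → Pred (V k) 0ℓ
S k i u v = IsDist k u v i

⟪_&_⟫ : {k : ℕ} → ZSet → ZSet → Pred (V k) 0ℓ
⟪ A & B ⟫ (x a) = A (+ toℕ a)
⟪ A & B ⟫ (y b) = B (+ toℕ b)

_≐_ : {k : ℕ} → Pred (V k) 0ℓ → Pred (V k) 0ℓ → Set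
P ≐ Q = ∀ v → P v ⇔ Q v

HasCard : {k : ℕ} → Pred (V k) 0ℓ → ℕ → Set
HasCard {k} P n = Σ (List (V k)) λ l → Unique l × length l ≡ n × (∀ v → (v ∈ l) ⇔ P v)

Ecc : (k : ℕ) → V k → ℕ → Set
Ecc k u e = (∀ v → ∃ λ d → d ℕ.≤ e × IsDist k u v d) × (∃ λ v → IsDist k u v e)

{-# OPTIONS --safe #-}
-- Put N = 2k+1, measure positions on the x-cycle ℤ_4N from x_{j-1} and on the y-cycle ℤ_2N
-- from y_j, and write a position as u + qN with 0 ≤ u < N, the residue u being 0, +c or -c
-- (1 ≤ c ≤ k).  An explicit function D of the residue and of the parity of q is the distance
-- from y_j.  D changes by at most one along every edge, because an edge moves the position
-- by 1 modulo 4N inside the x-cycle, and between the cycles by 1 modulo N or by N-1 modulo 2N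
-- (this is what the six offsets amount to); hence D is a lower bound for the distance.
-- Conversely every vertex is reached from y_j by an explicit walk of length D.  So S_i(y_j)
-- is the level set D = i, which is translated into the cosets of the statement and counted
-- by listing its points.
module Submission where

open import Defs
open import Data.Nat using (ℕ; suc; _≤_; NonZero)
open import Data.Fin using (Fin; toℕ)
open import Data.Integer using (ℤ; +_; -_)
open import Data.Product using (_×_)

module Congruence where

  import Data.Nat as ℕ
  import Data.Nat.Properties as ℕ
  import Data.Nat.Divisibility as ℕ
  import Data.Nat.DivMod as ℕ
  open import Data.Integer using (∣_∣; _+_; _-_; _*_)
  import Data.Integer.Properties as ℤ
  open import Data.Integer.Divisibility.Signed using (divides; ∣m⇒∣-m; ∣m∣n⇒∣m+n; ∣-trans; ∣ᵤ⇒∣; ∣⇒∣ᵤ)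
    renaming (_∣_ to _∣ₛ_)
  open import Data.Integer.DivMod using (_%ℕ_; _/ℕ_; a≡a%ℕn+[a/ℕn]*n; n%ℕd<d)
  open import Data.Integer.Tactic.RingSolver using (solve-∀)
  open import Data.Product using (Σ; _,_)
  open import Data.Sum using (inj₁; inj₂)
  open import Function using (_∘_)
  open import Function.Bundles using (_⇔_; mk⇔)
  open import Relation.Binary.Bundles using (Setoid)
  open import Relation.Binary.PropositionalEquality

  -- Defs' congruence unfolds to a divisibility statement from which a and b cannot be
  -- inferred; this record wrapper (over signed divisibility) keeps them visible.
  infix 4 _≋_[mod_]
  record _≋_[mod_] (a b : ℤ) (L : ℕ) : Set where
    constructor mod-divides
    field divides-difference : + L ∣ₛ a - b
  open _≋_[mod_] public

  small-multiple≡0 : ∀ {L d} → d ℕ.< L → L ℕ.∣ d → d ≡ 0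
  small-multiple≡0 {ℕ.suc _} {d} d<L L∣d = trans (sym (ℕ.m<n⇒m%n≡m d<L)) (ℕ.n∣m⇒m%n≡0 d _ L∣d)

  module _ {L : ℕ} where

    ≡⇒≋ : ∀ {a b} → a ≡ b [mod L ] → a ≋ b [mod L ]
    ≡⇒≋ p = mod-divides (∣ᵤ⇒∣ p)

    ≋⇒≡ : ∀ {a b} → a ≋ b [mod L ] → a ≡ b [mod L ]
    ≋⇒≡ p = ∣⇒∣ᵤ (divides-difference p)

    ≋-by-difference : ∀ {a b c d} → a - b ≡ c - d → a ≋ b [mod L ] → c ≋ d [mod L ]
    ≋-by-difference e (mod-divides p) = mod-divides (subst (+ L ∣ₛ_) e p)

    ≋-multiple : ∀ {a b} (t : ℤ) → a - b ≡ t * + L → a ≋ b [mod L ]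
    ≋-multiple t e = mod-divides (divides t e)

    ≋-reflexive : ∀ {a b} → a ≡ b → a ≋ b [mod L ]
    ≋-reflexive {a} refl = ≋-multiple (+ 0) (ℤ.+-inverseʳ a)

    ≋-refl : ∀ {a} → a ≋ a [mod L ]
    ≋-refl = ≋-reflexive refl

    ≋-sym : ∀ {a b} → a ≋ b [mod L ] → b ≋ a [mod L ]
    ≋-sym {a} {b} (mod-divides p) = mod-divides (subst (+ L ∣ₛ_) (flip a b) (∣m⇒∣-m p))
      where
      flip : ∀ a b → - (a - b) ≡ b - a
      flip = solve-∀

    ≋-trans : ∀ {a b c} → a ≋ b [mod L ] → b ≋ c [mod L ] → a ≋ c [mod L ]
    ≋-trans {a} {b} {c} (mod-divides p) (mod-divides q) =
      mod-divides (subst (+ L ∣ₛ_) (telescope a b c) (∣m∣n⇒∣m+n p q))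
      where
      telescope : ∀ a b c → (a - b) + (b - c) ≡ a - c
      telescope = solve-∀

    ≋-+ : ∀ {a b c d} → a ≋ b [mod L ] → c ≋ d [mod L ] → a + c ≋ b + d [mod L ]
    ≋-+ {a} {b} {c} {d} (mod-divides p) (mod-divides q) =
      mod-divides (subst (+ L ∣ₛ_) (regroup a b c d) (∣m∣n⇒∣m+n p q))
      where
      regroup : ∀ a b c d → (a - b) + (c - d) ≡ (a + c) - (b + d)
      regroup = solve-∀

    ≋-+ʳ : ∀ {a b} c → a ≋ b [mod L ] → a + c ≋ b + c [mod L ]
    ≋-+ʳ c p = ≋-+ p (≋-refl {c})

    ≋-+ˡ : ∀ c {a b} → a ≋ b [mod L ] → c + a ≋ c + b [mod L ]
    ≋-+ˡ c p = ≋-+ (≋-refl {c}) p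

    0≋modulus : + 0 ≋ + L [mod L ]
    0≋modulus = ≋-multiple (- + 1) (negation (+ L))
      where
      negation : ∀ l → + 0 - l ≡ - + 1 * l
      negation = solve-∀

    ≋-cancelˡ : ∀ c {a b} → c + a ≋ c + b [mod L ] → a ≋ b [mod L ]
    ≋-cancelˡ c {a} {b} = ≋-by-difference (cancel c a b)
      where
      cancel : ∀ c a b → (c + a) - (c + b) ≡ a - b
      cancel = solve-∀

    ≋-from-ℕ : ∀ {n m} a b → n ℕ.+ a ℕ.* L ≡ m ℕ.+ b ℕ.* L → + n ≋ + m [mod L ]
    ≋-from-ℕ {n} {m} a b e = ≋-multiple (+ b - + a) (shift (+ n) (+ a) (+ m) (+ b) (+ L) (begin
        + n + + a * + L    ≡⟨ cong (_+_ (+ n)) (ℤ.pos-* a L) ⟨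
        + n + + (a ℕ.* L)  ≡⟨ ℤ.pos-+ n (a ℕ.* L) ⟨
        + (n ℕ.+ a ℕ.* L)  ≡⟨ cong +_ e ⟩
        + (m ℕ.+ b ℕ.* L)  ≡⟨ ℤ.pos-+ m (b ℕ.* L) ⟩
        + m + + (b ℕ.* L)  ≡⟨ cong (_+_ (+ m)) (ℤ.pos-* b L) ⟩
        + m + + b * + L    ∎))
      where
      open ≡-Reasoning
      shift : ∀ n a m b l → n + a * l ≡ m + b * l → n - m ≡ (b - a) * l
      shift n a m b l e = trans (regroup n a m l) (trans (cong (λ t → t - m - a * l) e) (collect m b a l))
        where
        regroup : ∀ n a m l → n - m ≡ (n + a * l) - m - a * l
        regroup = solve-∀
        collect : ∀ m b a l → (m + b * l) - m - a * l ≡ (b - a) * l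
        collect = solve-∀

    ≋-cancel-ℕ : ∀ u {a b} → + (u ℕ.+ a) ≋ + (u ℕ.+ b) [mod L ] → + a ≋ + b [mod L ]
    ≋-cancel-ℕ u {a} {b} = ≋-cancelˡ (+ u) ∘ subst₂ _≋_[mod L ] (ℤ.pos-+ u a) (ℤ.pos-+ u b)

    ≋-+ℕˡ : ∀ a {b b′} → + b ≋ + b′ [mod L ] → + (a ℕ.+ b) ≋ + (a ℕ.+ b′) [mod L ]
    ≋-+ℕˡ a {b} {b′} = subst₂ _≋_[mod L ] (sym (ℤ.pos-+ a b)) (sym (ℤ.pos-+ a b′)) ∘ ≋-+ˡ (+ a)

    ≋-drop-multiple : ∀ u q → + (u ℕ.+ q ℕ.* L) ≋ + u [mod L ]
    ≋-drop-multiple u q = ≋-from-ℕ 0 q (ℕ.+-identityʳ (u ℕ.+ q ℕ.* L))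

    ≋-drop : ∀ t {a b} → a ≋ b + t * + L [mod L ] → a ≋ b [mod L ]
    ≋-drop t {a} {b} a≋b+tL = ≋-trans a≋b+tL (≋-multiple t (cancel b t (+ L)))
      where
      cancel : ∀ b t l → (b + t * l) - b ≡ t * l
      cancel = solve-∀

    ≋-lift : ∀ m .{{_ : NonZero m}} {a b} → a ≋ b [mod L ] →
             Σ ℕ λ r → r ℕ.< m × a ≋ b + + r * + L [mod m ℕ.* L ]
    ≋-lift m {a} {b} (mod-divides (divides t a-b≡tL)) = t %ℕ m , n%ℕd<d t m , mod-divides (divides (t /ℕ m) (begin
      a - (b + + (t %ℕ m) * + L)                               ≡⟨ regroup a b (+ (t %ℕ m)) (+ L) ⟩
      (a - b) - + (t %ℕ m) * + L                               ≡⟨ cong (λ z → z - + (t %ℕ m) * + L) a-b≡tL ⟩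
      t * + L - + (t %ℕ m) * + L                               ≡⟨ cong (λ z → z * + L - + (t %ℕ m) * + L) (a≡a%ℕn+[a/ℕn]*n t m) ⟩
      (+ (t %ℕ m) + (t /ℕ m) * + m) * + L - + (t %ℕ m) * + L  ≡⟨ collect (+ (t %ℕ m)) (t /ℕ m) (+ m) (+ L) ⟩
      t /ℕ m * (+ m * + L)                                     ≡⟨ cong (t /ℕ m *_) (ℤ.pos-* m L) ⟨
      t /ℕ m * + (m ℕ.* L)                                     ∎))
      where
      open ≡-Reasoning
      regroup : ∀ a b r l → a - (b + r * l) ≡ (a - b) - r * l
      regroup = solve-∀
      collect : ∀ r s m l → (r + s * m) * l - r * l ≡ s * (m * l)
      collect = solve-∀

    ≋-%ℕ : .{{_ : NonZero L}} → ∀ z → z ≋ + (z %ℕ L) [mod L ]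
    ≋-%ℕ z = ≋-multiple (z /ℕ L)
      (trans (cong (_- + (z %ℕ L)) (a≡a%ℕn+[a/ℕn]*n z L)) (cancel (+ (z %ℕ L)) (z /ℕ L) (+ L)))
      where
      cancel : ∀ r q l → (r + q * l) - r ≡ q * l
      cancel = solve-∀

    ≋⇒≡-ordered : ∀ {m n} → m ℕ.≤ n → n ℕ.< L → + m ≋ + n [mod L ] → m ≡ n
    ≋⇒≡-ordered {m} {n} m≤n n<L (mod-divides p) =
      ℕ.≤-antisym m≤n (ℕ.m∸n≡0⇒m≤n (small-multiple≡0 (ℕ.≤-<-trans (ℕ.m∸n≤m n m) n<L) L∣n∸m))
      where
      L∣n∸m : L ℕ.∣ n ℕ.∸ m
      L∣n∸m = subst (L ℕ.∣_) (trans (cong ∣_∣ (ℤ.m-n≡m⊖n m n)) (ℤ.∣⊖∣-≤ m≤n)) (∣⇒∣ᵤ p)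

    ≋⇒≡-< : ∀ {m n} → m ℕ.< L → n ℕ.< L → + m ≋ + n [mod L ] → m ≡ n
    ≋⇒≡-< {m} {n} m<L n<L m≋n with ℕ.≤-total m n
    ... | inj₁ m≤n = ≋⇒≡-ordered m≤n n<L m≋n
    ... | inj₂ n≤m = sym (≋⇒≡-ordered n≤m m<L (≋-sym m≋n))

  ≋-divisor : ∀ m {L a b} → a ≋ b [mod m ℕ.* L ] → a ≋ b [mod L ]
  ≋-divisor m {L} (mod-divides p) = mod-divides (∣-trans (divides (+ m) (ℤ.pos-* m L)) p)

  ≋-zero⇔ : ∀ {L a b} → a - b ≋ + 0 [mod L ] ⇔ a ≋ b [mod L ]
  ≋-zero⇔ {L} {a} {b} = mk⇔ (≋-by-difference (drop-zero a b)) (≋-by-difference (sym (drop-zero a b)))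
    where
    drop-zero : ∀ a b → (a - b) - + 0 ≡ a - b
    drop-zero = solve-∀

  ≋-+ʳ⇔ : ∀ {L a b} c → a ≋ b [mod L ] ⇔ a + c ≋ b + c [mod L ]
  ≋-+ʳ⇔ {L} {a} {b} c = mk⇔ (≋-+ʳ c) (≋-by-difference (cancel a b c))
    where
    cancel : ∀ a b c → (a + c) - (b + c) ≡ a - b
    cancel = solve-∀

  ≋-resp⇔ : ∀ {L a a′ b b′} → a ≋ a′ [mod L ] → b ≋ b′ [mod L ] → a ≋ b [mod L ] ⇔ a′ ≋ b′ [mod L ]
  ≋-resp⇔ a≋a′ b≋b′ = mk⇔ (λ a≋b → ≋-trans (≋-sym a≋a′) (≋-trans a≋b b≋b′))
                          (λ a′≋b′ → ≋-trans a≋a′ (≋-trans a′≋b′ (≋-sym b≋b′)))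

  generated⇔≋0 : ∀ {L M} m {h z} → h ≡ + M → L ≡ m ℕ.* M → ⟨ h ⟩[ L ] z ⇔ z ≋ + 0 [mod M ]
  generated⇔≋0 {M = M} m {z = z} refl refl = mk⇔ to from
    where
    to : ⟨ + M ⟩[ m ℕ.* M ] z → z ≋ + 0 [mod M ]
    to (n , z≡nM) = ≋-trans (≋-divisor m (≡⇒≋ z≡nM)) (≋-multiple n (ℤ.+-identityʳ (n * + M)))
    from : z ≋ + 0 [mod M ] → ⟨ + M ⟩[ m ℕ.* M ] z
    from (mod-divides (divides t z-0≡tM)) = t , ≋⇒≡ (≋-reflexive (trans (sym (ℤ.+-identityʳ z)) z-0≡tM))

  ≋-setoid : ℕ → Setoid _ _
  ≋-setoid L = record
    { Carrier = ℤ
    ; _≈_ = _≋_[mod L ]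
    ; isEquivalence = record { refl = ≋-refl ; sym = ≋-sym ; trans = ≋-trans }
    }

  module ≋-Reasoning (L : ℕ) where
    open import Relation.Binary.Reasoning.Setoid (≋-setoid L) public

module Cyclic (L : ℕ) .{{_ : NonZero L}} (origin : ℤ) where

  open import Data.Nat using (_<_)
  open import Data.Fin using (fromℕ<)
  open import Data.Fin.Properties using (toℕ-fromℕ<; toℕ-injective; toℕ<n)
  open import Data.Integer using (_+_; _-_)
  open import Data.Integer.DivMod using (_%ℕ_; n%ℕd<d)
  open import Data.Integer.Tactic.RingSolver using (solve-∀)
  open import Relation.Binary.PropositionalEquality
  open Congruence

  position : Fin L → ℕ
  position a = (+ toℕ a - origin) %ℕ L

  at : ℕ → Fin L
  at n = fromℕ< (n%ℕd<d (origin + + n) L)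

  position<L : ∀ a → position a < L
  position<L a = n%ℕd<d (+ toℕ a - origin) L

  position-≋ : ∀ a → + position a ≋ + toℕ a - origin [mod L ]
  position-≋ a = ≋-sym (≋-%ℕ (+ toℕ a - origin))

  at-≋ : ∀ n → + toℕ (at n) ≋ origin + + n [mod L ]
  at-≋ n = subst (λ t → + t ≋ origin + + n [mod L ]) (sym (toℕ-fromℕ< _)) (≋-sym (≋-%ℕ (origin + + n)))

  position-at : ∀ n → n < L → position (at n) ≡ n
  position-at n n<L = ≋⇒≡-< (position<L (at n)) n<L (begin
    + position (at n)           ≈⟨ position-≋ (at n) ⟩
    + toℕ (at n) - origin       ≈⟨ ≋-+ʳ (- origin) (at-≋ n) ⟩
    (origin + + n) - origin     ≡⟨ cancel origin (+ n) ⟩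
    + n                         ∎)
    where
    open ≋-Reasoning L
    cancel : ∀ o n → (o + n) - o ≡ n
    cancel = solve-∀

  at-position : ∀ a → at (position a) ≡ a
  at-position a = toℕ-injective (≋⇒≡-< (toℕ<n (at (position a))) (toℕ<n a) (begin
    + toℕ (at (position a))         ≈⟨ at-≋ (position a) ⟩
    origin + + position a           ≈⟨ ≋-+ˡ origin (position-≋ a) ⟩
    origin + (+ toℕ a - origin)     ≡⟨ cancel origin (+ toℕ a) ⟩
    + toℕ a                         ∎))
    where
    open ≋-Reasoning L
    cancel : ∀ o a → o + (a - o) ≡ a
    cancel = solve-∀

module Walks {k : ℕ} where

  open import Data.Nat using (_+_)
  open import Data.Sum using (inj₁; inj₂)

  adj-sym : ∀ {u v} → Adj k u v → Adj k v u
  adj-sym (inj₁ e) = inj₂ e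
  adj-sym (inj₂ e) = inj₁ e

  infixl 5 _▷_
  _▷_ : ∀ {u v w n} → Walk k u v n → Adj k v w → Walk k u w (suc n)
  here ▷ e = step e here
  step e′ p ▷ e = step e′ (p ▷ e)

  infixr 5 _++ʷ_
  _++ʷ_ : ∀ {u v w m n} → Walk k u v m → Walk k v w n → Walk k u w (m + n)
  here ++ʷ q = q
  step e p ++ʷ q = step e (p ++ʷ q)

data Residue : Set where
  0ᵣ : Residue
  +ᵣ_ -ᵣ_ : ℕ → Residue

module Residues (k : ℕ) (1≤k : 1 ≤ k) where

  open import Data.Nat using (zero; _+_; _*_; _∸_; _<_; z≤n; s≤s; _≤?_; _<?_; parity)
  open import Data.Nat.Properties
  open import Data.Nat.DivMod using (_/_; _%_; m%n<n; m≡m%n+[m/n]*n)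
  open import Data.Nat.Tactic.RingSolver using (solve-∀)
  import Data.Integer as ℤ
  import Data.Integer.Properties as ℤ
  open import Data.Parity.Base using (Parity; 0ℙ; 1ℙ)
  open import Data.Unit using (⊤; tt)
  open import Data.Empty using (⊥-elim)
  open import Data.Product using (_,_; proj₁; proj₂; uncurry)
  open import Function.Bundles using (_⇔_; mk⇔; Equivalence)
  open import Relation.Binary.PropositionalEquality
  open import Relation.Nullary using (yes; no)
  open Congruence

  N : ℕ
  N = suc (k + k)

  k<N : k < N
  k<N = s≤s (m≤m+n k k)

  N∸k≡1+k : N ∸ k ≡ suc k
  N∸k≡1+k = m+n∸n≡m (suc k) k

  value : Residue → ℕ
  value 0ᵣ = 0
  value (+ᵣ c) = c
  value (-ᵣ c) = N ∸ c

  Reduced : Residue → Set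
  Reduced 0ᵣ = ⊤
  Reduced (+ᵣ c) = 1 ≤ c × c ≤ k
  Reduced (-ᵣ c) = 1 ≤ c × c ≤ k

  value<N : ∀ r → Reduced r → value r < N
  value<N 0ᵣ _ = s≤s z≤n
  value<N (+ᵣ c) (_ , c≤k) = ≤-<-trans c≤k k<N
  value<N (-ᵣ suc c) _ = s≤s (m∸n≤m (k + k) c)

  residue : ℕ → Residue
  residue zero = 0ᵣ
  residue (suc u) with suc u ≤? k
  ... | yes _ = +ᵣ suc u
  ... | no _ = -ᵣ (N ∸ suc u)

  residue-reduced : ∀ u → u < N → Reduced (residue u)
  residue-reduced zero _ = tt
  residue-reduced (suc u) u<N with suc u ≤? k
  ... | yes u<k = s≤s z≤n , u<k
  ... | no u≮k = m<n⇒0<n∸m u<N , ≤-trans (∸-monoʳ-≤ N (≰⇒> u≮k)) (≤-reflexive (m+n∸n≡m k k))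

  value-residue : ∀ u → u < N → value (residue u) ≡ u
  value-residue zero _ = refl
  value-residue (suc u) u<N with suc u ≤? k
  ... | yes _ = refl
  ... | no _ = m∸[m∸n]≡n (<⇒≤ u<N)

  residue-above : ∀ w → k < w → residue w ≡ -ᵣ (N ∸ w)
  residue-above (suc u) k<w with suc u ≤? k
  ... | yes w≤k = ⊥-elim (<⇒≱ k<w w≤k)
  ... | no _ = refl

  residue-value : ∀ r → Reduced r → residue (value r) ≡ r
  residue-value 0ᵣ _ = refl
  residue-value (+ᵣ suc c) (_ , c<k) with suc c ≤? k
  ... | yes _ = refl
  ... | no c≮k = ⊥-elim (c≮k c<k)
  residue-value (-ᵣ c) (_ , c≤k) =
    trans (residue-above (N ∸ c) (m+n≤o⇒m≤o∸n (suc k) (s≤s (+-monoʳ-≤ k c≤k))))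
          (cong -ᵣ_ (m∸[m∸n]≡n (≤-trans c≤k (<⇒≤ k<N))))

  residue-unique : ∀ {u r} → u < N → Reduced r → + u ≋ + value r [mod N ] → residue u ≡ r
  residue-unique {u} {r} u<N r↓ u≋r = trans (cong residue (≋⇒≡-< u<N (value<N r r↓) u≋r)) (residue-value r r↓)

  sucᵣ : Residue → Residue
  sucᵣ 0ᵣ = +ᵣ 1
  sucᵣ (+ᵣ c) with c <? k
  ... | yes _ = +ᵣ suc c
  ... | no _ = -ᵣ k
  sucᵣ (-ᵣ suc (suc c)) = -ᵣ suc c
  sucᵣ (-ᵣ _) = 0ᵣ

  predᵣ : Residue → Residue
  predᵣ 0ᵣ = -ᵣ 1
  predᵣ (+ᵣ suc (suc c)) = +ᵣ suc c
  predᵣ (+ᵣ _) = 0ᵣ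
  predᵣ (-ᵣ c) with c <? k
  ... | yes _ = -ᵣ suc c
  ... | no _ = +ᵣ k

  sucᵣ-reduced : ∀ r → Reduced r → Reduced (sucᵣ r)
  sucᵣ-reduced 0ᵣ _ = ≤-refl , 1≤k
  sucᵣ-reduced (+ᵣ c) _ with c <? k
  ... | yes c<k = s≤s z≤n , c<k
  ... | no _ = 1≤k , ≤-refl
  sucᵣ-reduced (-ᵣ suc (suc c)) (_ , c≤k) = s≤s z≤n , ≤-trans (n≤1+n _) c≤k
  sucᵣ-reduced (-ᵣ suc zero) _ = tt

  predᵣ-reduced : ∀ r → Reduced r → Reduced (predᵣ r)
  predᵣ-reduced 0ᵣ _ = ≤-refl , 1≤k
  predᵣ-reduced (+ᵣ suc (suc c)) (_ , c≤k) = s≤s z≤n , ≤-trans (n≤1+n _) c≤k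
  predᵣ-reduced (+ᵣ suc zero) _ = tt
  predᵣ-reduced (-ᵣ c) _ with c <? k
  ... | yes c<k = s≤s z≤n , c<k
  ... | no _ = 1≤k , ≤-refl

  N∸c≡1+N∸[1+c] : ∀ c → c < N → N ∸ c ≡ suc (N ∸ suc c)
  N∸c≡1+N∸[1+c] c c<N = +-∸-assoc 1 c<N

  sucᵣ-value : ∀ r → Reduced r → r ≢ -ᵣ 1 → value (sucᵣ r) ≡ suc (value r)
  sucᵣ-value 0ᵣ _ _ = refl
  sucᵣ-value (+ᵣ c) (_ , c≤k) _ with c <? k
  ... | yes _ = refl
  ... | no c≮k rewrite ≤-antisym c≤k (≮⇒≥ c≮k) = N∸k≡1+k
  sucᵣ-value (-ᵣ suc (suc c)) (_ , c≤k) _ = N∸c≡1+N∸[1+c] (suc c) (≤-<-trans (≤-trans (n≤1+n _) c≤k) k<N)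
  sucᵣ-value (-ᵣ suc zero) _ r≢-1 = ⊥-elim (r≢-1 refl)

  sucᵣ-≋ : ∀ r → Reduced r → + value (sucᵣ r) ≋ + suc (value r) [mod N ]
  sucᵣ-≋ (-ᵣ suc zero) _ = 0≋modulus
  sucᵣ-≋ 0ᵣ _ = ≋-refl
  sucᵣ-≋ (+ᵣ c) c↓ = ≋-reflexive (cong +_ (sucᵣ-value (+ᵣ c) c↓ λ ()))
  sucᵣ-≋ (-ᵣ suc (suc c)) c↓ = ≋-reflexive (cong +_ (sucᵣ-value (-ᵣ suc (suc c)) c↓ λ ()))

  predᵣ-≋ : ∀ r → Reduced r → + suc (value (predᵣ r)) ≋ + value r [mod N ]
  predᵣ-≋ 0ᵣ _ = ≋-sym 0≋modulus
  predᵣ-≋ (+ᵣ suc (suc c)) _ = ≋-refl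
  predᵣ-≋ (+ᵣ suc zero) _ = ≋-refl
  predᵣ-≋ (-ᵣ c) (_ , c≤k) with c <? k
  ... | yes c<k = ≋-reflexive (cong +_ (sym (N∸c≡1+N∸[1+c] c (<-trans c<k k<N))))
  ... | no c≮k rewrite ≤-antisym c≤k (≮⇒≥ c≮k) = ≋-reflexive (cong +_ (sym N∸k≡1+k))


  join : ℕ → Residue → ℕ
  join q r = value r + q * N

  join≋value : ∀ q r → + join q r ≋ + value r [mod N ]
  join≋value q r = ≋-drop-multiple (value r) q

  reduced-unique : ∀ {r r′} → Reduced r → Reduced r′ → + value r ≋ + value r′ [mod N ] → r ≡ r′
  reduced-unique {r} r↓ r′↓ r≋r′ = trans (sym (residue-value r r↓)) (residue-unique (value<N r r↓) r′↓ r≋r′)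

  join-injective : ∀ {q q′ r r′} → Reduced r → Reduced r′ → join q r ≡ join q′ r′ → q ≡ q′ × r ≡ r′
  join-injective {q} {q′} {r} {r′} r↓ r′↓ e =
    *-cancelʳ-≡ q q′ N (+-cancelˡ-≡ (value r) _ _ (trans e (cong (λ u → u + q′ * N) (sym (cong value r≡r′))))) , r≡r′
    where
    r≡r′ : r ≡ r′
    r≡r′ = reduced-unique r↓ r′↓
      (≋-trans (≋-sym (join≋value q r)) (≋-trans (≋-reflexive (cong +_ e)) (join≋value q′ r′)))

  split : ℕ → ℕ × Residue
  split n = n / N , residue (n % N)

  split-reduced : ∀ n → Reduced (proj₂ (split n))
  split-reduced n = residue-reduced (n % N) (m%n<n n N)

  join-split : ∀ n → uncurry join (split n) ≡ n
  join-split n = trans (cong (_+ n / N * N) (value-residue (n % N) (m%n<n n N))) (sym (m≡m%n+[m/n]*n n N))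

  split-join : ∀ q r → Reduced r → split (join q r) ≡ (q , r)
  split-join q r r↓ = cong₂ _,_ (sym (proj₁ same)) (sym (proj₂ same))
    where
    same : q ≡ join q r / N × r ≡ residue (join q r % N)
    same = join-injective r↓ (split-reduced (join q r)) (sym (join-split (join q r)))

  join< : ∀ {q m} r → Reduced r → q < m → join q r < m * N
  join< {q} {suc m} r r↓ (s≤s q≤m) = +-mono-<-≤ (value<N r r↓) (*-monoˡ-≤ N q≤m)

  step-residue⁺ : ∀ {q q′ r r′} → Reduced r → Reduced r′ →
                  + join q′ r′ ≋ + suc (join q r) [mod N ] → sucᵣ r ≡ r′
  step-residue⁺ {q} {q′} {r} {r′} r↓ r′↓ shift = reduced-unique (sucᵣ-reduced r r↓) r′↓ (begin
    + value (sucᵣ r)  ≈⟨ sucᵣ-≋ r r↓ ⟩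
    + suc (value r)   ≈⟨ ≋-drop-multiple (suc (value r)) q ⟨
    + suc (join q r)  ≈⟨ shift ⟨
    + join q′ r′      ≈⟨ join≋value q′ r′ ⟩
    + value r′        ∎)
    where open ≋-Reasoning N

  step-residue⁻ : ∀ {q q′ r r′} → Reduced r → Reduced r′ →
                  + suc (join q′ r′) ≋ + (N + join q r) [mod N ] → predᵣ r ≡ r′
  step-residue⁻ {q} {q′} {r} {r′} r↓ r′↓ shift =
    reduced-unique (predᵣ-reduced r r↓) r′↓ (≋-cancel-ℕ 1 (begin
    + suc (value (predᵣ r))  ≈⟨ predᵣ-≋ r r↓ ⟩
    + value r                ≈⟨ join≋value q r ⟨
    + join q r               ≈⟨ ≋-drop-multiple (join q r) 1 ⟨
    + (join q r + 1 * N)     ≡⟨ cong +_ (+-comm (join q r) (1 * N)) ⟩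
    + (1 * N + join q r)     ≡⟨ cong (λ n → + (n + join q r)) (*-identityˡ N) ⟩
    + (N + join q r)         ≈⟨ shift ⟨
    + suc (join q′ r′)       ≈⟨ ≋-drop-multiple (suc (value r′)) q′ ⟩
    + suc (value r′)         ∎))
    where open ≋-Reasoning N

  signed : Residue → ℤ
  signed 0ᵣ = + 0
  signed (+ᵣ c) = + c
  signed (-ᵣ c) = - + c

  value≋signed : ∀ r → Reduced r → + value r ≋ signed r [mod N ]
  value≋signed 0ᵣ _ = ≋-refl
  value≋signed (+ᵣ c) _ = ≋-refl
  value≋signed (-ᵣ c) (_ , c≤k) = ≋-multiple (+ 1) (begin
    + (N ∸ c) ℤ.- - + c    ≡⟨ cong (ℤ._+_ (+ (N ∸ c))) (ℤ.neg-involutive (+ c)) ⟩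
    + (N ∸ c) ℤ.+ + c      ≡⟨ ℤ.pos-+ (N ∸ c) c ⟨
    + (N ∸ c + c)          ≡⟨ cong +_ (m∸n+n≡m (≤-trans c≤k (<⇒≤ k<N))) ⟩
    + N                    ≡⟨ ℤ.*-identityˡ (+ N) ⟨
    + 1 ℤ.* + N            ∎)
    where open ≡-Reasoning

  ≋-%N : ∀ u → + u ≋ + (u % N) [mod N ]
  ≋-%N u = subst (λ t → + t ≋ + (u % N) [mod N ]) (sym (m≡m%n+[m/n]*n u N)) (≋-drop-multiple (u % N) (u / N))

  residue≡⇔ : ∀ u r → Reduced r → residue (u % N) ≡ r ⇔ + u ≋ + value r [mod N ]
  residue≡⇔ u r r↓ = mk⇔ to from
    where
    to : residue (u % N) ≡ r → + u ≋ + value r [mod N ]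
    to refl = ≋-trans (≋-%N u) (≋-reflexive (cong +_ (sym (value-residue (u % N) (m%n<n u N)))))
    from : + u ≋ + value r [mod N ] → residue (u % N) ≡ r
    from u≋r = residue-unique (m%n<n u N) r↓ (≋-trans (≋-sym (≋-%N u)) u≋r)

  halfTurn : Parity → ℕ
  halfTurn 0ℙ = 0
  halfTurn 1ℙ = N

  multiple≋halfTurn : ∀ q → + (q * N) ≋ + halfTurn (parity q) [mod 2 * N ]
  multiple≋halfTurn zero = ≋-refl
  multiple≋halfTurn (suc zero) = ≋-reflexive (cong +_ (*-identityˡ N))
  multiple≋halfTurn (suc (suc q)) = ≋-trans (≋-from-ℕ 0 1 (two-turns q N)) (multiple≋halfTurn q)
    where
    two-turns : ∀ q n → (2 + q) * n + 0 * (2 * n) ≡ q * n + 1 * (2 * n)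
    two-turns = solve-∀

  halfTurn<2N : ∀ p → halfTurn p < 2 * N
  halfTurn<2N 0ℙ = s≤s z≤n
  halfTurn<2N 1ℙ = m<m+n N (s≤s z≤n)

  parity-unique : ∀ q q′ → + (q * N) ≋ + (q′ * N) [mod 2 * N ] → parity q ≡ parity q′
  parity-unique q q′ qN≋q′N = halfTurn-injective (parity q) (parity q′)
    (≋⇒≡-< (halfTurn<2N _) (halfTurn<2N _)
      (≋-trans (≋-sym (multiple≋halfTurn q)) (≋-trans qN≋q′N (multiple≋halfTurn q′))))
    where
    halfTurn-injective : ∀ p p′ → halfTurn p ≡ halfTurn p′ → p ≡ p′
    halfTurn-injective 0ℙ 0ℙ _ = refl
    halfTurn-injective 1ℙ 1ℙ _ = refl

  odd-minus≋ : ∀ c → c ≤ k → + join 1 (-ᵣ c) ≋ - + c [mod 2 * N ]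
  odd-minus≋ c c≤k = ≋-multiple (+ 1) (begin
    + ((N ∸ c) + 1 * N) ℤ.- - + c    ≡⟨ cong (ℤ._+_ (+ ((N ∸ c) + 1 * N))) (ℤ.neg-involutive (+ c)) ⟩
    + ((N ∸ c) + 1 * N) ℤ.+ + c      ≡⟨ ℤ.pos-+ ((N ∸ c) + 1 * N) c ⟨
    + ((N ∸ c) + 1 * N + c)          ≡⟨ cong +_ (around (N ∸ c) c N (m∸n+n≡m (≤-trans c≤k (<⇒≤ k<N)))) ⟩
    + (2 * N)                        ≡⟨ ℤ.*-identityˡ (+ (2 * N)) ⟨
    + 1 ℤ.* + (2 * N)                ∎)
    where
    open ≡-Reasoning
    around : ∀ a c n → a + c ≡ n → a + 1 * n + c ≡ 2 * n
    around a c _ refl = shuffle a c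
      where
      shuffle : ∀ a c → a + 1 * (a + c) + c ≡ 2 * (a + c)
      shuffle = solve-∀

  split-2N⇔ : ∀ u h r → Reduced r → + u ≋ + join h r [mod 2 * N ] ⇔ (residue (u % N) ≡ r × parity (u / N) ≡ parity h)
  split-2N⇔ u h r r↓ = mk⇔ to from
    where
    u≡ : residue (u % N) ≡ r → u ≡ join (u / N) r
    u≡ refl = sym (join-split u)
    to : + u ≋ + join h r [mod 2 * N ] → residue (u % N) ≡ r × parity (u / N) ≡ parity h
    to u≋ = res≡ , parity-unique (u / N) h
      (≋-cancel-ℕ (value r) (subst (λ t → + t ≋ + join h r [mod 2 * N ]) (u≡ res≡) u≋))
      where
      res≡ : residue (u % N) ≡ r
      res≡ = Equivalence.from (residue≡⇔ u r r↓) (≋-trans (≋-divisor 2 u≋) (join≋value h r))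
    from : residue (u % N) ≡ r × parity (u / N) ≡ parity h → + u ≋ + join h r [mod 2 * N ]
    from (res≡ , par≡) = subst (λ t → + t ≋ + join h r [mod 2 * N ]) (sym (u≡ res≡))
      (≋-+ℕˡ (value r) (≋-trans (multiple≋halfTurn (u / N))
        (subst (λ p → + halfTurn p ≋ + (h * N) [mod 2 * N ]) (sym par≡) (≋-sym (multiple≋halfTurn h)))))

data Point : Set where
  xᵖ yᵖ : ℕ → Residue → Point

module _ where

  open import Data.Nat.Properties using () renaming (_≟_ to _≟ℕ_)
  open import Relation.Binary.Definitions using (DecidableEquality)
  open import Relation.Binary.PropositionalEquality using (refl)
  open import Relation.Nullary using (yes; no)

  _≟ʳ_ : DecidableEquality Residue
  0ᵣ ≟ʳ 0ᵣ = yes refl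
  (+ᵣ c) ≟ʳ (+ᵣ c′) with c ≟ℕ c′
  ... | yes refl = yes refl
  ... | no c≢c′ = no λ { refl → c≢c′ refl }
  (-ᵣ c) ≟ʳ (-ᵣ c′) with c ≟ℕ c′
  ... | yes refl = yes refl
  ... | no c≢c′ = no λ { refl → c≢c′ refl }
  0ᵣ ≟ʳ (+ᵣ _) = no λ ()
  0ᵣ ≟ʳ (-ᵣ _) = no λ ()
  (+ᵣ _) ≟ʳ 0ᵣ = no λ ()
  (+ᵣ _) ≟ʳ (-ᵣ _) = no λ ()
  (-ᵣ _) ≟ʳ 0ᵣ = no λ ()
  (-ᵣ _) ≟ʳ (+ᵣ _) = no λ ()

  -- Quotients are compared before residues: the points of a level set differ in their quotient
  -- or in the sign of their residue, so they are told apart even when the size of the residue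
  -- is a variable.
  _≟ᵖ_ : DecidableEquality Point
  xᵖ q r ≟ᵖ xᵖ q′ r′ with q ≟ℕ q′
  ... | no q≢q′ = no λ { refl → q≢q′ refl }
  ... | yes refl with r ≟ʳ r′
  ...   | yes refl = yes refl
  ...   | no r≢r′ = no λ { refl → r≢r′ refl }
  yᵖ q r ≟ᵖ yᵖ q′ r′ with q ≟ℕ q′
  ... | no q≢q′ = no λ { refl → q≢q′ refl }
  ... | yes refl with r ≟ʳ r′
  ...   | yes refl = yes refl
  ...   | no r≢r′ = no λ { refl → r≢r′ refl }
  xᵖ _ _ ≟ᵖ yᵖ _ _ = no λ ()
  yᵖ _ _ ≟ᵖ xᵖ _ _ = no λ ()

Near : ℕ → ℕ → Set
Near a b = a ≤ suc b × b ≤ suc a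

module Profile (k-5 : ℕ) where

  import Data.Nat as ℕ
  open import Data.Nat using (_+_; _*_; z≤n; s≤s; _<?_; parity)
  open import Data.Nat.Properties using (≤-refl; ≤-trans; n≤1+n; ≤-antisym; ≮⇒≥)
  open import Data.Nat.DivMod using (_/_; _%_)
  open import Data.Parity.Base using (Parity; 0ℙ; 1ℙ)
  open import Data.Unit using (tt)
  open import Data.Product using (_,_)
  open import Data.Sum using (_⊎_; inj₁; inj₂)
  open import Data.List using (List; []; _∷_; _++_; map; concatMap; upTo)
  open import Data.List.Relation.Unary.Any as Any using (here; there)
  open import Data.List.Membership.Propositional using (_∈_; find)
  open import Data.List.Membership.Propositional.Properties
    using (∈-++⁺ˡ; ∈-++⁺ʳ; ∈-++⁻; ∈-map⁺; ∈-map⁻; ∈-concatMap⁺; ∈-concatMap⁻; ∈-upTo⁺; ∈-upTo⁻)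
  open import Data.List.Relation.Unary.Unique.Propositional using (Unique)
  open import Data.List.Relation.Unary.Unique.DecPropositional _≟ᵖ_ using (unique?)
  open import Function using (_∘_)
  open import Function.Bundles using (_⇔_; mk⇔)
  open import Relation.Binary.PropositionalEquality
  open import Relation.Nullary using (yes; no)
  open import Relation.Nullary.Decidable using (True; toWitness)

  k : ℕ
  k = 5 + k-5

  open Residues k (s≤s z≤n) public
  open Congruence

  detour : Parity → ℕ
  detour 0ℙ = 0
  detour 1ℙ = 2

  -- distX p r (resp. distY p r) is the distance from y_j of an x-vertex (resp. y-vertex) whose
  -- position has residue r and a quotient of parity p.
  distX : Parity → Residue → ℕ
  distX _ 0ᵣ = 2
  distX _ (+ᵣ c) = c
  distX p (-ᵣ 1) = detour p + 1
  distX p (-ᵣ 2) = detour p + 2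
  distX _ (-ᵣ c) = c

  distY : Parity → Residue → ℕ
  distY p 0ᵣ = detour p
  distY _ (+ᵣ 1) = 3
  distY _ (-ᵣ 1) = 3
  distY _ (+ᵣ c) = c
  distY _ (-ᵣ c) = c

  private
    near-refl : ∀ {a} → Near a a
    near-refl {a} = n≤1+n a , n≤1+n a

    near-suc : ∀ {a} → Near a (suc a)
    near-suc {a} = ≤-trans (n≤1+n a) (n≤1+n (suc a)) , ≤-refl

    near-sucˡ : ∀ {a} → Near (suc a) a
    near-sucˡ {a} = ≤-refl , ≤-trans (n≤1+n a) (n≤1+n (suc a))

    near-≡ : ∀ {a b} → a ≡ b → Near a b
    near-≡ refl = near-refl

  near-along-x : ∀ p p′ r → Reduced r → (r ≢ -ᵣ 1 → p ≡ p′) → Near (distX p r) (distX p′ (sucᵣ r))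
  near-along-x _ _ 0ᵣ _ _ = near-sucˡ
  near-along-x _ _ (+ᵣ c) (_ , c≤k) _ with c <? k
  ... | yes _ = near-suc
  ... | no c≮k = near-≡ (≤-antisym c≤k (≮⇒≥ c≮k))
  near-along-x 0ℙ _ (-ᵣ 1) _ _ = near-suc
  near-along-x 1ℙ _ (-ᵣ 1) _ _ = near-sucˡ
  near-along-x p p′ (-ᵣ 2) _ p≡p′ with p≡p′ (λ ())
  near-along-x 0ℙ 0ℙ (-ᵣ 2) _ _ | refl = near-sucˡ
  near-along-x 1ℙ 1ℙ (-ᵣ 2) _ _ | refl = near-sucˡ
  near-along-x _ 0ℙ (-ᵣ 3) _ _ = near-sucˡ
  near-along-x _ 1ℙ (-ᵣ 3) _ _ = near-suc
  near-along-x _ _ (-ᵣ suc (suc (suc (suc c)))) _ _ = near-sucˡ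

  near-along-y⁺ : ∀ p p′ r → Reduced r → Near (distY p r) (distX p′ (sucᵣ r))
  near-along-y⁺ 0ℙ _ 0ᵣ _ = near-suc
  near-along-y⁺ 1ℙ _ 0ᵣ _ = near-sucˡ
  near-along-y⁺ _ _ (+ᵣ 1) _ = near-sucˡ
  near-along-y⁺ _ _ (+ᵣ suc (suc c)) (_ , c≤k) with suc (suc c) <? k
  ... | yes _ = near-suc
  ... | no c≮k = near-≡ (≤-antisym c≤k (≮⇒≥ c≮k))
  near-along-y⁺ _ _ (-ᵣ 1) _ = near-sucˡ
  near-along-y⁺ _ 0ℙ (-ᵣ 2) _ = near-sucˡ
  near-along-y⁺ _ 1ℙ (-ᵣ 2) _ = near-suc
  near-along-y⁺ _ 0ℙ (-ᵣ 3) _ = near-sucˡ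
  near-along-y⁺ _ 1ℙ (-ᵣ 3) _ = near-suc
  near-along-y⁺ _ _ (-ᵣ suc (suc (suc (suc c)))) _ = near-sucˡ

  near-along-y⁻ : ∀ p p′ r → Reduced r → (r ≡ 0ᵣ → p′ ≡ p) → Near (distY p r) (distX p′ (predᵣ r))
  near-along-y⁻ p p′ 0ᵣ _ p′≡p with p′≡p refl
  near-along-y⁻ 0ℙ 0ℙ 0ᵣ _ _ | refl = near-suc
  near-along-y⁻ 1ℙ 1ℙ 0ᵣ _ _ | refl = near-suc
  near-along-y⁻ _ _ (+ᵣ 1) _ _ = near-sucˡ
  near-along-y⁻ _ _ (+ᵣ 2) _ _ = near-sucˡ
  near-along-y⁻ _ _ (+ᵣ suc (suc (suc c))) _ _ = near-sucˡ
  near-along-y⁻ _ 0ℙ (-ᵣ 1) _ _ = near-sucˡ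
  near-along-y⁻ _ 1ℙ (-ᵣ 1) _ _ = near-suc
  near-along-y⁻ _ _ (-ᵣ 2) _ _ = near-suc
  near-along-y⁻ _ _ (-ᵣ suc (suc (suc c))) (_ , c≤k) _ with suc (suc (suc c)) <? k
  ... | yes _ = near-suc
  ... | no c≮k = near-≡ (≤-antisym c≤k (≮⇒≥ c≮k))

  near-x-join : ∀ q q′ r r′ → Reduced r → Reduced r′ → + join q′ r′ ≋ + suc (join q r) [mod 2 * N ] →
                Near (distX (parity q) r) (distX (parity q′) r′)
  near-x-join q q′ r r′ r↓ r′↓ shift =
    subst (λ s → Near (distX (parity q) r) (distX (parity q′) s)) sucᵣr≡r′
          (near-along-x (parity q) (parity q′) r r↓ same-parity)
    where
    sucᵣr≡r′ : sucᵣ r ≡ r′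
    sucᵣr≡r′ = step-residue⁺ {q} {q′} r↓ r′↓ (≋-divisor 2 shift)
    same-parity : r ≢ -ᵣ 1 → parity q ≡ parity q′
    same-parity r≢-1 = sym (parity-unique q′ q (≋-cancel-ℕ (suc (value r))
      (subst (λ u → + (u + q′ * N) ≋ + suc (join q r) [mod 2 * N ])
             (trans (cong value (sym sucᵣr≡r′)) (sucᵣ-value r r↓ r≢-1)) shift)))

  near-y-join⁺ : ∀ q q′ r r′ → Reduced r → Reduced r′ → + join q′ r′ ≋ + suc (join q r) [mod N ] →
                 Near (distY (parity q) r) (distX (parity q′) r′)
  near-y-join⁺ q q′ r r′ r↓ r′↓ shift =
    subst (λ s → Near (distY (parity q) r) (distX (parity q′) s)) (step-residue⁺ {q} {q′} r↓ r′↓ shift)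
          (near-along-y⁺ (parity q) (parity q′) r r↓)

  near-y-join⁻ : ∀ q q′ r r′ → Reduced r → Reduced r′ → + suc (join q′ r′) ≋ + (N + join q r) [mod 2 * N ] →
                 Near (distY (parity q) r) (distX (parity q′) r′)
  near-y-join⁻ q q′ r r′ r↓ r′↓ shift =
    subst (λ s → Near (distY (parity q) r) (distX (parity q′) s)) predᵣr≡r′
          (near-along-y⁻ (parity q) (parity q′) r r↓ same-parity)
    where
    predᵣr≡r′ : predᵣ r ≡ r′
    predᵣr≡r′ = step-residue⁻ {q} {q′} r↓ r′↓ (≋-divisor 2 shift)
    same-parity : r ≡ 0ᵣ → parity q′ ≡ parity q
    same-parity refl = parity-unique q′ q (≋-cancel-ℕ N
      (subst (λ s → + suc (join q′ s) ≋ + (N + join q 0ᵣ) [mod 2 * N ]) (sym predᵣr≡r′) shift))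

  profileX : ℕ → ℕ
  profileX n = distX (parity (n / N)) (residue (n % N))

  profileY : ℕ → ℕ
  profileY n = distY (parity (n / N)) (residue (n % N))

  near-x-step : ∀ n n′ → + n′ ≋ + suc n [mod 2 * N ] → Near (profileX n) (profileX n′)
  near-x-step n n′ = near-x-join (n / N) (n′ / N) _ _ (split-reduced n) (split-reduced n′)
    ∘ subst₂ (λ a b → + a ≋ + suc b [mod 2 * N ]) (sym (join-split n′)) (sym (join-split n))

  near-y-step⁺ : ∀ n n′ → + n′ ≋ + suc n [mod N ] → Near (profileY n) (profileX n′)
  near-y-step⁺ n n′ = near-y-join⁺ (n / N) (n′ / N) _ _ (split-reduced n) (split-reduced n′)
    ∘ subst₂ (λ a b → + a ≋ + suc b [mod N ]) (sym (join-split n′)) (sym (join-split n))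

  near-y-step⁻ : ∀ n n′ → + suc n′ ≋ + (N + n) [mod 2 * N ] → Near (profileY n) (profileX n′)
  near-y-step⁻ n n′ = near-y-join⁻ (n / N) (n′ / N) _ _ (split-reduced n) (split-reduced n′)
    ∘ subst₂ (λ a b → + suc a ≋ + (N + b) [mod 2 * N ]) (sym (join-split n′)) (sym (join-split n))

  distX≡2⇔ : ∀ p r → distX p r ≡ 2 ⇔ ((r ≡ +ᵣ 2 ⊎ r ≡ 0ᵣ) ⊎ (r ≡ -ᵣ 2 × p ≡ 0ℙ))
  distX≡2⇔ p r = mk⇔ (to p r) from
    where
    to : ∀ p r → distX p r ≡ 2 → (r ≡ +ᵣ 2 ⊎ r ≡ 0ᵣ) ⊎ (r ≡ -ᵣ 2 × p ≡ 0ℙ)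
    to _ 0ᵣ _ = inj₁ (inj₂ refl)
    to _ (+ᵣ c) refl = inj₁ (inj₁ refl)
    to 0ℙ (-ᵣ 2) _ = inj₂ (refl , refl)
    to 0ℙ (-ᵣ 1) ()
    to 1ℙ (-ᵣ 1) ()
    to 1ℙ (-ᵣ 2) ()
    to _ (-ᵣ 0) ()
    to _ (-ᵣ suc (suc (suc c))) ()
    from : (r ≡ +ᵣ 2 ⊎ r ≡ 0ᵣ) ⊎ (r ≡ -ᵣ 2 × p ≡ 0ℙ) → distX p r ≡ 2
    from (inj₁ (inj₁ refl)) = refl
    from (inj₁ (inj₂ refl)) = refl
    from (inj₂ (refl , refl)) = refl

  distX≡3⇔ : ∀ p r → distX p r ≡ 3 ⇔ ((r ≡ +ᵣ 3 ⊎ r ≡ -ᵣ 3) ⊎ (r ≡ -ᵣ 1 × p ≡ 1ℙ))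
  distX≡3⇔ p r = mk⇔ (to p r) from
    where
    to : ∀ p r → distX p r ≡ 3 → (r ≡ +ᵣ 3 ⊎ r ≡ -ᵣ 3) ⊎ (r ≡ -ᵣ 1 × p ≡ 1ℙ)
    to _ (+ᵣ c) refl = inj₁ (inj₁ refl)
    to _ (-ᵣ 3) _ = inj₁ (inj₂ refl)
    to 1ℙ (-ᵣ 1) _ = inj₂ (refl , refl)
    to 0ℙ (-ᵣ 1) ()
    to 0ℙ (-ᵣ 2) ()
    to 1ℙ (-ᵣ 2) ()
    to _ 0ᵣ ()
    to _ (-ᵣ 0) ()
    to _ (-ᵣ suc (suc (suc (suc c)))) ()
    from : (r ≡ +ᵣ 3 ⊎ r ≡ -ᵣ 3) ⊎ (r ≡ -ᵣ 1 × p ≡ 1ℙ) → distX p r ≡ 3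
    from (inj₁ (inj₁ refl)) = refl
    from (inj₁ (inj₂ refl)) = refl
    from (inj₂ (refl , refl)) = refl

  distX≡4⇔ : ∀ p r → distX p r ≡ 4 ⇔ ((r ≡ +ᵣ 4 ⊎ r ≡ -ᵣ 4) ⊎ (r ≡ -ᵣ 2 × p ≡ 1ℙ))
  distX≡4⇔ p r = mk⇔ (to p r) from
    where
    to : ∀ p r → distX p r ≡ 4 → (r ≡ +ᵣ 4 ⊎ r ≡ -ᵣ 4) ⊎ (r ≡ -ᵣ 2 × p ≡ 1ℙ)
    to _ (+ᵣ c) refl = inj₁ (inj₁ refl)
    to _ (-ᵣ 4) _ = inj₁ (inj₂ refl)
    to 1ℙ (-ᵣ 2) _ = inj₂ (refl , refl)
    to 0ℙ (-ᵣ 1) ()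
    to 1ℙ (-ᵣ 1) ()
    to 0ℙ (-ᵣ 2) ()
    to _ 0ᵣ ()
    to _ (-ᵣ 0) ()
    to _ (-ᵣ 3) ()
    to _ (-ᵣ suc (suc (suc (suc (suc c))))) ()
    from : (r ≡ +ᵣ 4 ⊎ r ≡ -ᵣ 4) ⊎ (r ≡ -ᵣ 2 × p ≡ 1ℙ) → distX p r ≡ 4
    from (inj₁ (inj₁ refl)) = refl
    from (inj₁ (inj₂ refl)) = refl
    from (inj₂ (refl , refl)) = refl

  distX≡far⇔ : ∀ p r m → distX p r ≡ 5 + m ⇔ (r ≡ +ᵣ (5 + m) ⊎ r ≡ -ᵣ (5 + m))
  distX≡far⇔ p r m = mk⇔ (to p r) from
    where
    to : ∀ p r → distX p r ≡ 5 + m → r ≡ +ᵣ (5 + m) ⊎ r ≡ -ᵣ (5 + m)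
    to _ (+ᵣ c) refl = inj₁ refl
    to _ (-ᵣ suc (suc (suc c))) refl = inj₂ refl
    to 0ℙ (-ᵣ 1) ()
    to 1ℙ (-ᵣ 1) ()
    to 0ℙ (-ᵣ 2) ()
    to 1ℙ (-ᵣ 2) ()
    to _ 0ᵣ ()
    to _ (-ᵣ 0) ()
    from : r ≡ +ᵣ (5 + m) ⊎ r ≡ -ᵣ (5 + m) → distX p r ≡ 5 + m
    from (inj₁ refl) = refl
    from (inj₂ refl) = refl

  distY≡2⇔ : ∀ p r → distY p r ≡ 2 ⇔ ((r ≡ +ᵣ 2 ⊎ r ≡ -ᵣ 2) ⊎ (r ≡ 0ᵣ × p ≡ 1ℙ))
  distY≡2⇔ p r = mk⇔ (to p r) from
    where
    to : ∀ p r → distY p r ≡ 2 → (r ≡ +ᵣ 2 ⊎ r ≡ -ᵣ 2) ⊎ (r ≡ 0ᵣ × p ≡ 1ℙ)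
    to 1ℙ 0ᵣ _ = inj₂ (refl , refl)
    to 0ℙ 0ᵣ ()
    to _ (+ᵣ 2) _ = inj₁ (inj₁ refl)
    to _ (-ᵣ 2) _ = inj₁ (inj₂ refl)
    to _ (+ᵣ 0) ()
    to _ (+ᵣ 1) ()
    to _ (+ᵣ suc (suc (suc c))) ()
    to _ (-ᵣ 0) ()
    to _ (-ᵣ 1) ()
    to _ (-ᵣ suc (suc (suc c))) ()
    from : (r ≡ +ᵣ 2 ⊎ r ≡ -ᵣ 2) ⊎ (r ≡ 0ᵣ × p ≡ 1ℙ) → distY p r ≡ 2
    from (inj₁ (inj₁ refl)) = refl
    from (inj₁ (inj₂ refl)) = refl
    from (inj₂ (refl , refl)) = refl

  distY≡3⇔ : ∀ p r → distY p r ≡ 3 ⇔ ((r ≡ +ᵣ 3 ⊎ r ≡ -ᵣ 3) ⊎ (r ≡ +ᵣ 1 ⊎ r ≡ -ᵣ 1))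
  distY≡3⇔ p r = mk⇔ (to p r) from
    where
    to : ∀ p r → distY p r ≡ 3 → (r ≡ +ᵣ 3 ⊎ r ≡ -ᵣ 3) ⊎ (r ≡ +ᵣ 1 ⊎ r ≡ -ᵣ 1)
    to _ (+ᵣ 1) _ = inj₂ (inj₁ refl)
    to _ (-ᵣ 1) _ = inj₂ (inj₂ refl)
    to _ (+ᵣ 3) _ = inj₁ (inj₁ refl)
    to _ (-ᵣ 3) _ = inj₁ (inj₂ refl)
    to 0ℙ 0ᵣ ()
    to 1ℙ 0ᵣ ()
    to _ (+ᵣ 0) ()
    to _ (+ᵣ 2) ()
    to _ (+ᵣ suc (suc (suc (suc c)))) ()
    to _ (-ᵣ 0) ()
    to _ (-ᵣ 2) ()
    to _ (-ᵣ suc (suc (suc (suc c)))) ()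
    from : (r ≡ +ᵣ 3 ⊎ r ≡ -ᵣ 3) ⊎ (r ≡ +ᵣ 1 ⊎ r ≡ -ᵣ 1) → distY p r ≡ 3
    from (inj₁ (inj₁ refl)) = refl
    from (inj₁ (inj₂ refl)) = refl
    from (inj₂ (inj₁ refl)) = refl
    from (inj₂ (inj₂ refl)) = refl

  distY≡far⇔ : ∀ p r m → distY p r ≡ 4 + m ⇔ (r ≡ +ᵣ (4 + m) ⊎ r ≡ -ᵣ (4 + m))
  distY≡far⇔ p r m = mk⇔ (to p r) from
    where
    to : ∀ p r → distY p r ≡ 4 + m → r ≡ +ᵣ (4 + m) ⊎ r ≡ -ᵣ (4 + m)
    to _ (+ᵣ suc (suc c)) refl = inj₁ refl
    to _ (-ᵣ suc (suc c)) refl = inj₂ refl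
    to 0ℙ 0ᵣ ()
    to 1ℙ 0ᵣ ()
    to _ (+ᵣ 0) ()
    to _ (+ᵣ 1) ()
    to _ (-ᵣ 0) ()
    to _ (-ᵣ 1) ()
    from : r ≡ +ᵣ (4 + m) ⊎ r ≡ -ᵣ (4 + m) → distY p r ≡ 4 + m
    from (inj₁ refl) = refl
    from (inj₂ refl) = refl

  Valid : Point → Set
  Valid (xᵖ q r) = q ℕ.< 4 × Reduced r
  Valid (yᵖ q r) = q ℕ.< 2 × Reduced r

  profile : Point → ℕ
  profile (xᵖ q r) = distX (parity q) r
  profile (yᵖ q r) = distY (parity q) r

  distX≤k : ∀ p r → Reduced r → distX p r ℕ.≤ k
  distX≤k _ 0ᵣ _ = s≤s (s≤s z≤n)
  distX≤k _ (+ᵣ c) (_ , c≤k) = c≤k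
  distX≤k 0ℙ (-ᵣ 1) _ = s≤s z≤n
  distX≤k 1ℙ (-ᵣ 1) _ = s≤s (s≤s (s≤s z≤n))
  distX≤k 0ℙ (-ᵣ 2) _ = s≤s (s≤s z≤n)
  distX≤k 1ℙ (-ᵣ 2) _ = s≤s (s≤s (s≤s (s≤s z≤n)))
  distX≤k _ (-ᵣ suc (suc (suc c))) (_ , c≤k) = c≤k

  distY≤k : ∀ p r → Reduced r → distY p r ℕ.≤ k
  distY≤k 0ℙ 0ᵣ _ = z≤n
  distY≤k 1ℙ 0ᵣ _ = s≤s (s≤s z≤n)
  distY≤k _ (+ᵣ 1) _ = s≤s (s≤s (s≤s z≤n))
  distY≤k _ (-ᵣ 1) _ = s≤s (s≤s (s≤s z≤n))
  distY≤k _ (+ᵣ suc (suc c)) (_ , c≤k) = c≤k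
  distY≤k _ (-ᵣ suc (suc c)) (_ , c≤k) = c≤k

  profile≤k : ∀ p → Valid p → profile p ℕ.≤ k
  profile≤k (xᵖ q r) (_ , r↓) = distX≤k (parity q) r r↓
  profile≤k (yᵖ q r) (_ , r↓) = distY≤k (parity q) r r↓

  levelX : ℕ → Parity → List Residue
  levelX 0 _ = []
  levelX 1 0ℙ = +ᵣ 1 ∷ -ᵣ 1 ∷ []
  levelX 1 1ℙ = +ᵣ 1 ∷ []
  levelX 2 0ℙ = 0ᵣ ∷ +ᵣ 2 ∷ -ᵣ 2 ∷ []
  levelX 2 1ℙ = 0ᵣ ∷ +ᵣ 2 ∷ []
  levelX 3 0ℙ = +ᵣ 3 ∷ -ᵣ 3 ∷ []
  levelX 3 1ℙ = +ᵣ 3 ∷ -ᵣ 3 ∷ -ᵣ 1 ∷ []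
  levelX 4 0ℙ = +ᵣ 4 ∷ -ᵣ 4 ∷ []
  levelX 4 1ℙ = +ᵣ 4 ∷ -ᵣ 4 ∷ -ᵣ 2 ∷ []
  levelX i _ = +ᵣ i ∷ -ᵣ i ∷ []

  levelY : ℕ → Parity → List Residue
  levelY 0 0ℙ = 0ᵣ ∷ []
  levelY 0 1ℙ = []
  levelY 1 _ = []
  levelY 2 0ℙ = +ᵣ 2 ∷ -ᵣ 2 ∷ []
  levelY 2 1ℙ = +ᵣ 2 ∷ -ᵣ 2 ∷ 0ᵣ ∷ []
  levelY 3 _ = +ᵣ 3 ∷ -ᵣ 3 ∷ +ᵣ 1 ∷ -ᵣ 1 ∷ []
  levelY i _ = +ᵣ i ∷ -ᵣ i ∷ []

  ∈-levelX : ∀ p r → Reduced r → r ∈ levelX (distX p r) p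
  ∈-levelX 0ℙ 0ᵣ _ = here refl
  ∈-levelX 1ℙ 0ᵣ _ = here refl
  ∈-levelX 0ℙ (+ᵣ 1) _ = here refl
  ∈-levelX 1ℙ (+ᵣ 1) _ = here refl
  ∈-levelX 0ℙ (+ᵣ 2) _ = there (here refl)
  ∈-levelX 1ℙ (+ᵣ 2) _ = there (here refl)
  ∈-levelX 0ℙ (+ᵣ 3) _ = here refl
  ∈-levelX 1ℙ (+ᵣ 3) _ = here refl
  ∈-levelX 0ℙ (+ᵣ 4) _ = here refl
  ∈-levelX 1ℙ (+ᵣ 4) _ = here refl
  ∈-levelX _ (+ᵣ suc (suc (suc (suc (suc c))))) _ = here refl
  ∈-levelX 0ℙ (-ᵣ 1) _ = there (here refl)
  ∈-levelX 1ℙ (-ᵣ 1) _ = there (there (here refl))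
  ∈-levelX 0ℙ (-ᵣ 2) _ = there (there (here refl))
  ∈-levelX 1ℙ (-ᵣ 2) _ = there (there (here refl))
  ∈-levelX 0ℙ (-ᵣ 3) _ = there (here refl)
  ∈-levelX 1ℙ (-ᵣ 3) _ = there (here refl)
  ∈-levelX 0ℙ (-ᵣ 4) _ = there (here refl)
  ∈-levelX 1ℙ (-ᵣ 4) _ = there (here refl)
  ∈-levelX _ (-ᵣ suc (suc (suc (suc (suc c))))) _ = there (here refl)

  ∈-levelY : ∀ p r → Reduced r → r ∈ levelY (distY p r) p
  ∈-levelY 0ℙ 0ᵣ _ = here refl
  ∈-levelY 1ℙ 0ᵣ _ = there (there (here refl))
  ∈-levelY _ (+ᵣ 1) _ = there (there (here refl))
  ∈-levelY _ (-ᵣ 1) _ = there (there (there (here refl)))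
  ∈-levelY 0ℙ (+ᵣ 2) _ = here refl
  ∈-levelY 1ℙ (+ᵣ 2) _ = here refl
  ∈-levelY 0ℙ (-ᵣ 2) _ = there (here refl)
  ∈-levelY 1ℙ (-ᵣ 2) _ = there (here refl)
  ∈-levelY _ (+ᵣ 3) _ = here refl
  ∈-levelY _ (-ᵣ 3) _ = there (here refl)
  ∈-levelY _ (+ᵣ suc (suc (suc (suc c)))) _ = here refl
  ∈-levelY _ (-ᵣ suc (suc (suc (suc c)))) _ = there (here refl)

  private
    within : ∀ {c i} → 1 ℕ.≤ c → c ℕ.≤ i → i ℕ.≤ k → 1 ℕ.≤ c × c ℕ.≤ k
    within 1≤c c≤i i≤k = 1≤c , ≤-trans c≤i i≤k

    1≤1 : 1 ℕ.≤ 1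
    1≤1 = s≤s z≤n

    1≤2 : 1 ℕ.≤ 2
    1≤2 = s≤s z≤n

  levelX-sound : ∀ i p r → i ℕ.≤ k → r ∈ levelX i p → Reduced r × distX p r ≡ i
  levelX-sound 1 0ℙ _ i≤k (here refl) = within 1≤1 ≤-refl i≤k , refl
  levelX-sound 1 0ℙ _ i≤k (there (here refl)) = within 1≤1 ≤-refl i≤k , refl
  levelX-sound 1 1ℙ _ i≤k (here refl) = within 1≤1 ≤-refl i≤k , refl
  levelX-sound 2 0ℙ _ _ (here refl) = tt , refl
  levelX-sound 2 0ℙ _ i≤k (there (here refl)) = within 1≤2 ≤-refl i≤k , refl
  levelX-sound 2 0ℙ _ i≤k (there (there (here refl))) = within 1≤2 ≤-refl i≤k , refl
  levelX-sound 2 1ℙ _ _ (here refl) = tt , refl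
  levelX-sound 2 1ℙ _ i≤k (there (here refl)) = within 1≤2 ≤-refl i≤k , refl
  levelX-sound 3 0ℙ _ i≤k (here refl) = within (s≤s z≤n) ≤-refl i≤k , refl
  levelX-sound 3 0ℙ _ i≤k (there (here refl)) = within (s≤s z≤n) ≤-refl i≤k , refl
  levelX-sound 3 1ℙ _ i≤k (here refl) = within (s≤s z≤n) ≤-refl i≤k , refl
  levelX-sound 3 1ℙ _ i≤k (there (here refl)) = within (s≤s z≤n) ≤-refl i≤k , refl
  levelX-sound 3 1ℙ _ i≤k (there (there (here refl))) = within 1≤1 (s≤s z≤n) i≤k , refl
  levelX-sound 4 0ℙ _ i≤k (here refl) = within (s≤s z≤n) ≤-refl i≤k , refl
  levelX-sound 4 0ℙ _ i≤k (there (here refl)) = within (s≤s z≤n) ≤-refl i≤k , refl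
  levelX-sound 4 1ℙ _ i≤k (here refl) = within (s≤s z≤n) ≤-refl i≤k , refl
  levelX-sound 4 1ℙ _ i≤k (there (here refl)) = within (s≤s z≤n) ≤-refl i≤k , refl
  levelX-sound 4 1ℙ _ i≤k (there (there (here refl))) = within 1≤2 (s≤s (s≤s z≤n)) i≤k , refl
  levelX-sound (suc (suc (suc (suc (suc m))))) _ _ i≤k (here refl) = within (s≤s z≤n) ≤-refl i≤k , refl
  levelX-sound (suc (suc (suc (suc (suc m))))) _ _ i≤k (there (here refl)) = within (s≤s z≤n) ≤-refl i≤k , refl

  levelY-sound : ∀ i p r → i ℕ.≤ k → r ∈ levelY i p → Reduced r × distY p r ≡ i
  levelY-sound 0 0ℙ _ _ (here refl) = tt , refl
  levelY-sound 2 0ℙ _ i≤k (here refl) = within 1≤2 ≤-refl i≤k , refl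
  levelY-sound 2 0ℙ _ i≤k (there (here refl)) = within 1≤2 ≤-refl i≤k , refl
  levelY-sound 2 1ℙ _ i≤k (here refl) = within 1≤2 ≤-refl i≤k , refl
  levelY-sound 2 1ℙ _ i≤k (there (here refl)) = within 1≤2 ≤-refl i≤k , refl
  levelY-sound 2 1ℙ _ _ (there (there (here refl))) = tt , refl
  levelY-sound 3 _ _ i≤k (here refl) = within (s≤s z≤n) ≤-refl i≤k , refl
  levelY-sound 3 _ _ i≤k (there (here refl)) = within (s≤s z≤n) ≤-refl i≤k , refl
  levelY-sound 3 _ _ i≤k (there (there (here refl))) = within 1≤1 (s≤s z≤n) i≤k , refl
  levelY-sound 3 _ _ i≤k (there (there (there (here refl)))) = within 1≤1 (s≤s z≤n) i≤k , refl
  levelY-sound (suc (suc (suc (suc m)))) _ _ i≤k (here refl) = within (s≤s z≤n) ≤-refl i≤k , refl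
  levelY-sound (suc (suc (suc (suc m)))) _ _ i≤k (there (here refl)) = within (s≤s z≤n) ≤-refl i≤k , refl

  levelPointsX levelPointsY : ℕ → ℕ → List Point
  levelPointsX i q = map (xᵖ q) (levelX i (parity q))
  levelPointsY i q = map (yᵖ q) (levelY i (parity q))

  level : ℕ → List Point
  level i = concatMap (levelPointsX i) (upTo 4) ++ concatMap (levelPointsY i) (upTo 2)

  ∈-level⇔ : ∀ i p → i ℕ.≤ k → p ∈ level i ⇔ (Valid p × profile p ≡ i)
  ∈-level⇔ i p i≤k = mk⇔ (to p) (from p)
    where
    at-quotient : ∀ {m} (f : ℕ → List Point) {p q} → q ℕ.< m → p ∈ f q → p ∈ concatMap f (upTo m)
    at-quotient f q<m p∈fq = ∈-concatMap⁺ f (Any.map (λ { refl → p∈fq }) (∈-upTo⁺ q<m))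
    to : ∀ p → p ∈ level i → Valid p × profile p ≡ i
    to p p∈ with ∈-++⁻ (concatMap (levelPointsX i) (upTo 4)) p∈
    ... | inj₁ p∈x with find (∈-concatMap⁻ (levelPointsX i) {xs = upTo 4} p∈x)
    ...   | q , q∈ , p∈q with ∈-map⁻ (xᵖ q) p∈q
    ...     | r , r∈ , refl with levelX-sound i (parity q) r i≤k r∈
    ...       | r↓ , d≡i = (∈-upTo⁻ q∈ , r↓) , d≡i
    to p p∈ | inj₂ p∈y with find (∈-concatMap⁻ (levelPointsY i) {xs = upTo 2} p∈y)
    ...   | q , q∈ , p∈q with ∈-map⁻ (yᵖ q) p∈q
    ...     | r , r∈ , refl with levelY-sound i (parity q) r i≤k r∈
    ...       | r↓ , d≡i = (∈-upTo⁻ q∈ , r↓) , d≡i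
    from : ∀ p → Valid p × profile p ≡ i → p ∈ level i
    from (xᵖ q r) ((q<4 , r↓) , refl) =
      ∈-++⁺ˡ (at-quotient (levelPointsX i) q<4 (∈-map⁺ (xᵖ q) (∈-levelX (parity q) r r↓)))
    from (yᵖ q r) ((q<2 , r↓) , refl) =
      ∈-++⁺ʳ (concatMap (levelPointsX i) (upTo 4)) (at-quotient (levelPointsY i) q<2 (∈-map⁺ (yᵖ q) (∈-levelY (parity q) r r↓)))



  level-unique : ∀ i → {True (unique? (level i))} → Unique (level i)
  level-unique i {decided} = toWitness {a? = unique? (level i)} decided

module Graph (k-5 : ℕ) where

  import Data.Nat as ℕ
  import Data.Nat.Properties as ℕ
  open import Data.Nat using (suc; _<_; z≤n; s≤s)
  import Data.Nat.Tactic.RingSolver as ℕ-Solver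
  open import Data.Integer using (_+_; _-_; _*_)
  import Data.Integer.Properties as ℤ
  open import Data.Integer.Tactic.RingSolver using (solve-∀)
  open import Data.List.Relation.Unary.Any using (Any; here; there)
  open import Data.Product using (Σ; _×_; _,_)
  open import Data.Sum using (_⊎_; inj₁; inj₂)
  open import Function using (_∘_)
  open import Function.Bundles using (_⇔_; mk⇔)
  open import Relation.Binary.PropositionalEquality
  open Congruence
  open Profile k-5 public

  N-as-ℤ : + N ≡ + 2 * + k + + 1
  N-as-ℤ = trans (ℤ.pos-+ 1 (k ℕ.+ k)) (trans (cong (_+_ (+ 1)) (ℤ.pos-+ k k)) (double (+ k)))
    where
    double : ∀ k → + 1 + (k + k) ≡ + 2 * k + + 1
    double = solve-∀

  Lx≡4N : Lx k ≡ 4 ℕ.* N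
  Lx≡4N = quadruple k
    where
    quadruple : ∀ k → 8 ℕ.* k ℕ.+ 4 ≡ 4 ℕ.* ℕ.suc (k ℕ.+ k)
    quadruple = ℕ-Solver.solve-∀

  Ly≡2N : Ly k ≡ 2 ℕ.* N
  Ly≡2N = double k
    where
    double : ∀ k → 4 ℕ.* k ℕ.+ 2 ≡ 2 ℕ.* ℕ.suc (k ℕ.+ k)
    double = ℕ-Solver.solve-∀

  Lx≡2[2N] : Lx k ≡ 2 ℕ.* (2 ℕ.* N)
  Lx≡2[2N] = trans Lx≡4N (twice N)
    where
    twice : ∀ n → 4 ℕ.* n ≡ 2 ℕ.* (2 ℕ.* n)
    twice = ℕ-Solver.solve-∀

  modLx⇒mod2N : ∀ {a b} → a ≋ b [mod Lx k ] → a ≋ b [mod 2 ℕ.* N ]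
  modLx⇒mod2N {a} {b} = ≋-divisor 2 ∘ subst (a ≋ b [mod_]) Lx≡2[2N]

  modLx⇒modN : ∀ {a b} → a ≋ b [mod Lx k ] → a ≋ b [mod N ]
  modLx⇒modN {a} {b} = ≋-divisor 4 ∘ subst (a ≋ b [mod_]) Lx≡4N

  modLy⇒mod2N : ∀ {a b} → a ≋ b [mod Ly k ] → a ≋ b [mod 2 ℕ.* N ]
  modLy⇒mod2N {a} {b} = subst (a ≋ b [mod_]) Ly≡2N

  modLy⇒modN : ∀ {a b} → a ≋ b [mod Ly k ] → a ≋ b [mod N ]
  modLy⇒modN = ≋-divisor 2 ∘ modLy⇒mod2N

  2N-as-ℤ : + (2 ℕ.* N) ≡ + 4 * + k + + 2
  2N-as-ℤ = trans (ℤ.pos-* 2 N) (trans (cong (+ 2 *_) N-as-ℤ) (double (+ k)))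
    where
    double : ∀ k → + 2 * (+ 2 * k + + 1) ≡ + 4 * k + + 2
    double = solve-∀

  N∸2-as-ℤ : + (N ℕ.∸ 2) ≡ + N - + 2
  N∸2-as-ℤ = trans (sym (ℤ.⊖-≥ (s≤s (s≤s z≤n)))) (sym (ℤ.m-n≡m⊖n N 2))

  private
    offset₀ : ∀ K → + 0 ≡ + 0 * (+ 2 * K + + 1)
    offset₀ = solve-∀
    offset₁ : ∀ K → + 2 * K - + 1 ≡ (+ 2 * K - + 1) + + 0 * (+ 4 * K + + 2)
    offset₁ = solve-∀
    offset₂ : ∀ K → + 2 * K + + 1 ≡ + 1 * (+ 2 * K + + 1)
    offset₂ = solve-∀
    offset₃ : ∀ K → + 4 * K + + 2 ≡ + 2 * (+ 2 * K + + 1)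
    offset₃ = solve-∀
    offset₄ : ∀ K → + 6 * K + + 1 ≡ (+ 2 * K - + 1) + + 1 * (+ 4 * K + + 2)
    offset₄ = solve-∀
    offset₅ : ∀ K → + 6 * K + + 3 ≡ + 3 * (+ 2 * K + + 1)
    offset₅ = solve-∀
    skew-shape : ∀ I K t → I + ((+ 2 * K - + 1) + t * (+ 4 * K + + 2)) ≡ (I + ((+ 2 * K + + 1) - + 2)) + t * (+ 4 * K + + 2)
    skew-shape = solve-∀

  -- The offsets 0, 2k+1, 4k+2, 6k+3 are the multiples of N modulo 4N, and 2k-1, 6k+1 are the
  -- two lifts of N-2 from ℤ_2N to ℤ_4N.
  y-adjacency⇔ : ∀ A I → Any (λ m → A ≡ I + m [mod Lx k ]) (offsets k) ⇔
                         (A ≋ I [mod N ] ⊎ A ≋ I + (+ N - + 2) [mod 2 ℕ.* N ])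
  y-adjacency⇔ A I = mk⇔ classify realise
    where
    K = + k
    whole : ∀ t {m} → m ≡ t * (+ 2 * K + + 1) → A ≡ I + m [mod Lx k ] → A ≋ I [mod N ]
    whole t m≡tN A≡I+m =
      ≋-drop t (subst (λ m → A ≋ I + m [mod N ]) (trans m≡tN (cong (t *_) (sym N-as-ℤ))) (modLx⇒modN (≡⇒≋ A≡I+m)))
    skew : ∀ t {m} → m ≡ (+ 2 * K - + 1) + t * (+ 4 * K + + 2) →
           A ≡ I + m [mod Lx k ] → A ≋ I + (+ N - + 2) [mod 2 ℕ.* N ]
    skew t m≡ A≡I+m = ≋-drop t (subst (λ z → A ≋ z [mod 2 ℕ.* N ]) shape (modLx⇒mod2N (≡⇒≋ A≡I+m)))
      where
      shape : I + _ ≡ (I + (+ N - + 2)) + t * + (2 ℕ.* N)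
      shape = trans (cong (_+_ I) m≡)
        (trans (skew-shape I K t) (sym (cong₂ (λ n n₂ → (I + (n - + 2)) + t * n₂) N-as-ℤ 2N-as-ℤ)))
    classify : Any (λ m → A ≡ I + m [mod Lx k ]) (offsets k) → A ≋ I [mod N ] ⊎ A ≋ I + (+ N - + 2) [mod 2 ℕ.* N ]
    classify (here p) = inj₁ (whole (+ 0) (offset₀ K) p)
    classify (there (here p)) = inj₂ (skew (+ 0) (offset₁ K) p)
    classify (there (there (here p))) = inj₁ (whole (+ 1) (offset₂ K) p)
    classify (there (there (there (here p)))) = inj₁ (whole (+ 2) (offset₃ K) p)
    classify (there (there (there (there (here p))))) = inj₂ (skew (+ 1) (offset₄ K) p)
    classify (there (there (there (there (there (here p)))))) = inj₁ (whole (+ 3) (offset₅ K) p)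
    hit : ∀ {L m z} → L ≡ Lx k → z ≡ I + m → A ≋ z [mod L ] → A ≡ I + m [mod Lx k ]
    hit refl refl = ≋⇒≡
    hit-whole : ∀ r {m} → + r * (+ 2 * K + + 1) ≡ m → A ≋ I + + r * + N [mod 4 ℕ.* N ] → A ≡ I + m [mod Lx k ]
    hit-whole r e = hit (sym Lx≡4N) (cong (_+_ I) (trans (cong (+ r *_) N-as-ℤ) e))
    hit-skew : ∀ r {m} → (I + ((+ 2 * K + + 1) - + 2)) + + r * (+ 4 * K + + 2) ≡ I + m →
               A ≋ (I + (+ N - + 2)) + + r * + (2 ℕ.* N) [mod 2 ℕ.* (2 ℕ.* N) ] → A ≡ I + m [mod Lx k ]
    hit-skew r e = hit (sym Lx≡2[2N]) (trans (cong₂ (λ n n₂ → (I + (n - + 2)) + + r * n₂) N-as-ℤ 2N-as-ℤ) e)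
    realise : A ≋ I [mod N ] ⊎ A ≋ I + (+ N - + 2) [mod 2 ℕ.* N ] → Any (λ m → A ≡ I + m [mod Lx k ]) (offsets k)
    realise (inj₁ A≋I) = whole-case (≋-lift 4 A≋I)
      where
      whole-case : Σ ℕ (λ r → r < 4 × A ≋ I + + r * + N [mod 4 ℕ.* N ]) →
                   Any (λ m → A ≡ I + m [mod Lx k ]) (offsets k)
      whole-case (0 , _ , A≋) = here (hit-whole 0 (sym (offset₀ K)) A≋)
      whole-case (1 , _ , A≋) = there (there (here (hit-whole 1 (sym (offset₂ K)) A≋)))
      whole-case (2 , _ , A≋) = there (there (there (here (hit-whole 2 (sym (offset₃ K)) A≋))))
      whole-case (3 , _ , A≋) = there (there (there (there (there (here (hit-whole 3 (sym (offset₅ K)) A≋))))))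
      whole-case (suc (suc (suc (suc _))) , s≤s (s≤s (s≤s (s≤s ()))) , _)
    realise (inj₂ A≋I+N-2) = skew-case (≋-lift 2 A≋I+N-2)
      where
      skew-case : Σ ℕ (λ r → r < 2 × A ≋ (I + (+ N - + 2)) + + r * + (2 ℕ.* N) [mod 2 ℕ.* (2 ℕ.* N) ]) →
                  Any (λ m → A ≡ I + m [mod Lx k ]) (offsets k)
      skew-case (0 , _ , A≋) =
        there (here (hit-skew 0 (trans (sym (skew-shape I K (+ 0))) (cong (_+_ I) (sym (offset₁ K)))) A≋))
      skew-case (1 , _ , A≋) =
        there (there (there (there (here (hit-skew 1 (trans (sym (skew-shape I K (+ 1))) (cong (_+_ I) (sym (offset₄ K)))) A≋)))))
      skew-case (suc (suc _) , s≤s (s≤s ()) , _)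

module Coordinates (k-5 : ℕ) (j : Fin (Ly (Profile.k k-5))) where

  open import Data.Nat using (_<_; parity)
  open import Data.Parity.Base using (Parity)
  open import Data.Nat.DivMod using (_/_; _%_; m<n*o⇒m/o<n)
  open import Data.Integer using (_-_)
  open import Data.Product using (_,_; uncurry)
  open import Relation.Binary.PropositionalEquality
  open Congruence
  open Graph k-5 public

  jℤ : ℤ
  jℤ = + toℕ j

  -- Positions on the x-cycle are measured from x_{j-1}, those on the y-cycle from y_j.
  module X = Cyclic (Lx k) (jℤ - + 1)
  module Y = Cyclic (Ly k) jℤ

  coord : V k → Point
  coord (x a) = uncurry xᵖ (split (X.position a))
  coord (y b) = uncurry yᵖ (split (Y.position b))

  vertex : Point → V k
  vertex (xᵖ q r) = x (X.at (join q r))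
  vertex (yᵖ q r) = y (Y.at (join q r))

  D : V k → ℕ
  D v = profile (coord v)

  coord-valid : ∀ v → Valid (coord v)
  coord-valid (x a) = m<n*o⇒m/o<n (subst (X.position a <_) Lx≡4N (X.position<L a)) , split-reduced (X.position a)
  coord-valid (y b) = m<n*o⇒m/o<n (subst (Y.position b <_) Ly≡2N (Y.position<L b)) , split-reduced (Y.position b)

  vertex-coord : ∀ v → vertex (coord v) ≡ v
  vertex-coord (x a) = cong x (trans (cong X.at (join-split (X.position a))) (X.at-position a))
  vertex-coord (y b) = cong y (trans (cong Y.at (join-split (Y.position b))) (Y.at-position b))

  coord-vertex : ∀ p → Valid p → coord (vertex p) ≡ p
  coord-vertex (xᵖ q r) (q<4 , r↓) =
    cong (uncurry xᵖ) (trans (cong split (X.position-at (join q r) (subst (join q r <_) (sym Lx≡4N) (join< r r↓ q<4))))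
                             (split-join q r r↓))
  coord-vertex (yᵖ q r) (q<2 , r↓) =
    cong (uncurry yᵖ) (trans (cong split (Y.position-at (join q r) (subst (join q r <_) (sym Ly≡2N) (join< r r↓ q<2))))
                             (split-join q r r↓))

  rX : Fin (Lx k) → Residue
  rX a = residue (X.position a % N)

  pX : Fin (Lx k) → Parity
  pX a = parity (X.position a / N)

  rY : Fin (Ly k) → Residue
  rY b = residue (Y.position b % N)

  pY : Fin (Ly k) → Parity
  pY b = parity (Y.position b / N)

module Distance (k-5 : ℕ) (j : Fin (Ly (Profile.k k-5))) where

  import Data.Nat as ℕ
  import Data.Nat.Properties as ℕ
  open import Data.Nat using (zero; suc; _<_; z≤n; s≤s; parity)
  import Data.Nat.Tactic.RingSolver as ℕ-Solver
  open import Data.Integer using (_+_; _-_)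
  import Data.Integer.Properties as ℤ
  open import Data.Integer.Tactic.RingSolver using (solve-∀)
  open import Data.Integer.DivMod using (_%ℕ_)
  open import Data.Parity.Base using (0ℙ)
  open import Data.Empty using (⊥-elim)
  open import Data.Product using (_,_; proj₂; swap)
  open import Data.Sum using (inj₁; inj₂)
  open import Function.Bundles using (_⇔_; mk⇔; Equivalence)
  open import Relation.Binary.PropositionalEquality
  open import Relation.Nullary using (yes; no)
  open Congruence
  open Coordinates k-5 j public

  private
    +-suc-ℤ : ∀ n → + n + + 1 ≡ + suc n
    +-suc-ℤ n = trans (ℤ.+-comm (+ n) (+ 1)) (sym (ℤ.pos-+ 1 n))
    shift-x : ∀ a o → (a + + 1) - o ≡ (a - o) + + 1
    shift-x = solve-∀
    shift-y⁺ : ∀ i o → i - (o - + 1) ≡ (i - o) + + 1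
    shift-y⁺ = solve-∀
    shift-y⁻ : ∀ i o n → ((i + (n - + 2)) - (o - + 1)) + + 1 ≡ (i - o) + n
    shift-y⁻ = solve-∀

  near-on-edge : ∀ {u v} → Edge k u v → Near (D u) (D v)
  near-on-edge (xx a b b≡a+1) = near-x-step (X.position a) (X.position b) (modLx⇒mod2N (begin
    + X.position b                       ≈⟨ X.position-≋ b ⟩
    + toℕ b - (jℤ - + 1)                 ≈⟨ ≋-+ʳ (- (jℤ - + 1)) (≡⇒≋ {Lx k} {+ toℕ b} {+ toℕ a + + 1} b≡a+1) ⟩
    (+ toℕ a + + 1) - (jℤ - + 1)         ≡⟨ shift-x (+ toℕ a) (jℤ - + 1) ⟩
    (+ toℕ a - (jℤ - + 1)) + + 1         ≈⟨ ≋-+ʳ (+ 1) (X.position-≋ a) ⟨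
    + X.position a + + 1                 ≡⟨ +-suc-ℤ (X.position a) ⟩
    + suc (X.position a)                 ∎))
    where open ≋-Reasoning (Lx k)
  near-on-edge (yx i a adjacent) with Equivalence.to (y-adjacency⇔ (+ toℕ a) (+ toℕ i)) adjacent
  ... | inj₁ a≋i = near-y-step⁺ (Y.position i) (X.position a) (begin
    + X.position a               ≈⟨ modLx⇒modN (X.position-≋ a) ⟩
    + toℕ a - (jℤ - + 1)         ≈⟨ ≋-+ʳ (- (jℤ - + 1)) a≋i ⟩
    + toℕ i - (jℤ - + 1)         ≡⟨ shift-y⁺ (+ toℕ i) jℤ ⟩
    (+ toℕ i - jℤ) + + 1         ≈⟨ ≋-+ʳ (+ 1) (modLy⇒modN (Y.position-≋ i)) ⟨
    + Y.position i + + 1         ≡⟨ +-suc-ℤ (Y.position i) ⟩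
    + suc (Y.position i)         ∎)
    where open ≋-Reasoning N
  ... | inj₂ a≋i+N-2 = near-y-step⁻ (Y.position i) (X.position a) (begin
    + suc (X.position a)                              ≡⟨ +-suc-ℤ (X.position a) ⟨
    + X.position a + + 1                              ≈⟨ ≋-+ʳ (+ 1) (modLx⇒mod2N (X.position-≋ a)) ⟩
    (+ toℕ a - (jℤ - + 1)) + + 1                      ≈⟨ ≋-+ʳ (+ 1) (≋-+ʳ (- (jℤ - + 1)) a≋i+N-2) ⟩
    ((+ toℕ i + (+ N - + 2)) - (jℤ - + 1)) + + 1      ≡⟨ shift-y⁻ (+ toℕ i) jℤ (+ N) ⟩
    (+ toℕ i - jℤ) + + N                              ≈⟨ ≋-+ʳ (+ N) (modLy⇒mod2N (Y.position-≋ i)) ⟨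
    + Y.position i + + N                              ≡⟨ trans (ℤ.+-comm (+ Y.position i) (+ N)) (sym (ℤ.pos-+ N (Y.position i))) ⟩
    + (N ℕ.+ Y.position i)                            ∎)
    where open ≋-Reasoning (2 ℕ.* N)

  near-on-adjacent : ∀ {u v} → Adj k u v → Near (D u) (D v)
  near-on-adjacent (inj₁ e) = near-on-edge e
  near-on-adjacent (inj₂ e) = swap (near-on-edge e)

  D-≤-walk : ∀ {u v n} → Walk k u v n → D v ℕ.≤ D u ℕ.+ n
  D-≤-walk {u} here = ℕ.≤-reflexive (sym (ℕ.+-identityʳ (D u)))
  D-≤-walk {u} {n = suc n} (step u∼w w⇝v) = ℕ.≤-trans (D-≤-walk w⇝v)
    (ℕ.≤-trans (ℕ.+-monoˡ-≤ n (proj₂ (near-on-adjacent u∼w))) (ℕ.≤-reflexive (sym (ℕ.+-suc (D u) n))))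

  private
    regroup-suc : ∀ o n → o + (+ 1 + n) ≡ (o + n) + + 1
    regroup-suc = solve-∀
    regroup-origin : ∀ j m → (j - + 1) + (+ 1 + m) ≡ j + m
    regroup-origin = solve-∀
    regroup-skew : ∀ j n → (j - + 1) + n ≡ (j - + 2) + (+ 1 + n)
    regroup-skew = solve-∀
    regroup-skew′ : ∀ j m n → (j - + 2) + (n + m) ≡ (j + m) + (n - + 2)
    regroup-skew′ = solve-∀

  x-step-adj : ∀ n → Adj k (x (X.at n)) (x (X.at (suc n)))
  x-step-adj n = inj₁ (xx (X.at n) (X.at (suc n)) (≋⇒≡ (begin
    + toℕ (X.at (suc n))            ≈⟨ X.at-≋ (suc n) ⟩
    (jℤ - + 1) + + suc n            ≡⟨ cong (_+_ (jℤ - + 1)) (ℤ.pos-+ 1 n) ⟩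
    (jℤ - + 1) + (+ 1 + + n)        ≡⟨ regroup-suc (jℤ - + 1) (+ n) ⟩
    ((jℤ - + 1) + + n) + + 1        ≈⟨ ≋-+ʳ (+ 1) (X.at-≋ n) ⟨
    + toℕ (X.at n) + + 1            ∎)))
    where open ≋-Reasoning (Lx k)

  y-adj⁺ : ∀ m n → + n ≋ + suc m [mod N ] → Adj k (y (Y.at m)) (x (X.at n))
  y-adj⁺ m n n≋1+m =
    inj₁ (yx (Y.at m) (X.at n) (Equivalence.from (y-adjacency⇔ (+ toℕ (X.at n)) (+ toℕ (Y.at m))) (inj₁ (begin
    + toℕ (X.at n)                  ≈⟨ modLx⇒modN (X.at-≋ n) ⟩
    (jℤ - + 1) + + n                ≈⟨ ≋-+ˡ (jℤ - + 1) n≋1+m ⟩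
    (jℤ - + 1) + + suc m            ≡⟨ cong (_+_ (jℤ - + 1)) (ℤ.pos-+ 1 m) ⟩
    (jℤ - + 1) + (+ 1 + + m)        ≡⟨ regroup-origin jℤ (+ m) ⟩
    jℤ + + m                        ≈⟨ modLy⇒modN (Y.at-≋ m) ⟨
    + toℕ (Y.at m)                  ∎))))
    where open ≋-Reasoning N

  y-adj⁻ : ∀ m n → + suc n ≋ + (N ℕ.+ m) [mod 2 ℕ.* N ] → Adj k (y (Y.at m)) (x (X.at n))
  y-adj⁻ m n 1+n≋N+m =
    inj₁ (yx (Y.at m) (X.at n) (Equivalence.from (y-adjacency⇔ (+ toℕ (X.at n)) (+ toℕ (Y.at m))) (inj₂ (begin
    + toℕ (X.at n)                  ≈⟨ modLx⇒mod2N (X.at-≋ n) ⟩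
    (jℤ - + 1) + + n                ≡⟨ regroup-skew jℤ (+ n) ⟩
    (jℤ - + 2) + (+ 1 + + n)        ≡⟨ cong (_+_ (jℤ - + 2)) (ℤ.pos-+ 1 n) ⟨
    (jℤ - + 2) + + suc n            ≈⟨ ≋-+ˡ (jℤ - + 2) 1+n≋N+m ⟩
    (jℤ - + 2) + + (N ℕ.+ m)        ≡⟨ cong (_+_ (jℤ - + 2)) (ℤ.pos-+ N m) ⟩
    (jℤ - + 2) + (+ N + + m)        ≡⟨ regroup-skew′ jℤ (+ m) (+ N) ⟩
    (jℤ + + m) + (+ N - + 2)        ≈⟨ ≋-+ʳ (+ N - + 2) (modLy⇒mod2N (Y.at-≋ m)) ⟨
    + toℕ (Y.at m) + (+ N - + 2)    ∎))))
    where open ≋-Reasoning (2 ℕ.* N)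

  open Walks

  origin : V k
  origin = y (Y.at 0)

  x-forward : ∀ n c → Walk k (x (X.at n)) (x (X.at (c ℕ.+ n))) c
  x-forward n zero = here
  x-forward n (suc c) = x-forward n c ▷ x-step-adj (c ℕ.+ n)

  x-backward : ∀ n c → Walk k (x (X.at (c ℕ.+ n))) (x (X.at n)) c
  x-backward n zero = here
  x-backward n (suc c) = step (adj-sym (x-step-adj (c ℕ.+ n))) (x-backward n c)

  enter : ∀ q → Adj k origin (x (X.at (suc (q ℕ.* N))))
  enter q = y-adj⁺ 0 (suc (q ℕ.* N)) (≋-drop-multiple 1 q)

  private
    two-turns : ∀ a → suc (a ℕ.+ 2 ℕ.* suc a) ℕ.+ 0 ℕ.* (2 ℕ.* suc a) ≡
                      (suc a ℕ.+ 0) ℕ.+ 1 ℕ.* (2 ℕ.* suc a)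
    two-turns = ℕ-Solver.solve-∀

  walk-x-minus₁ : ∀ q → q < 4 → Walk k origin (x (X.at (join q (-ᵣ 1)))) (distX (parity q) (-ᵣ 1))
  walk-x-minus₁ 0 _ = step (y-adj⁻ 0 (join 0 (-ᵣ 1)) ≋-refl) here
  walk-x-minus₁ 1 _ = step (enter 2) (x-backward (join 1 (-ᵣ 1)) 2)
  walk-x-minus₁ 2 _ = step (y-adj⁻ 0 (join 2 (-ᵣ 1)) (≋-from-ℕ 0 1 (two-turns (k ℕ.+ k)))) here
  walk-x-minus₁ 3 _ = step (enter 4) (x-backward (join 3 (-ᵣ 1)) 2)
  walk-x-minus₁ (suc (suc (suc (suc _)))) (s≤s (s≤s (s≤s (s≤s ()))))

  private
    wrap-twice : ∀ a n q → (a ℕ.+ q ℕ.* n) ℕ.+ 1 ℕ.* (2 ℕ.* n) ≡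
                           (n ℕ.+ (a ℕ.+ (n ℕ.+ q ℕ.* n))) ℕ.+ 0 ℕ.* (2 ℕ.* n)
    wrap-twice = ℕ-Solver.solve-∀

    back-to-far : ∀ c q → 3 ℕ.+ c ℕ.≤ N →
                  c ℕ.+ ((N ℕ.∸ (3 ℕ.+ c)) ℕ.+ q ℕ.* N) ≡ (N ℕ.∸ 3) ℕ.+ q ℕ.* N
    back-to-far c q 3+c≤N = begin
      c ℕ.+ ((N ℕ.∸ (3 ℕ.+ c)) ℕ.+ q ℕ.* N)   ≡⟨ ℕ.+-assoc c _ _ ⟨
      (c ℕ.+ (N ℕ.∸ (3 ℕ.+ c))) ℕ.+ q ℕ.* N   ≡⟨ cong (λ t → (c ℕ.+ t) ℕ.+ q ℕ.* N) (ℕ.∸-+-assoc N 3 c) ⟨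
      (c ℕ.+ (N ℕ.∸ 3 ℕ.∸ c)) ℕ.+ q ℕ.* N     ≡⟨ cong (ℕ._+ q ℕ.* N) (ℕ.m+[n∸m]≡n c≤N∸3) ⟩
      (N ℕ.∸ 3) ℕ.+ q ℕ.* N                   ∎
      where
      open ≡-Reasoning
      c≤N∸3 : c ℕ.≤ N ℕ.∸ 3
      c≤N∸3 = ℕ.m+n≤o⇒m≤o∸n c (subst (ℕ._≤ N) (ℕ.+-comm 3 c) 3+c≤N)

  walk-x-far : ∀ q c → 3 ℕ.+ c ℕ.≤ k → Walk k origin (x (X.at (join q (-ᵣ (3 ℕ.+ c))))) (3 ℕ.+ c)
  walk-x-far q c 3+c≤k =
    to-N-3 ++ʷ subst (λ n → Walk k (x (X.at n)) (x (X.at far)) c) (back-to-far c q 3+c≤N) (x-backward far c)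
    where
    3+c≤N : 3 ℕ.+ c ℕ.≤ N
    3+c≤N = ℕ.≤-trans 3+c≤k (ℕ.<⇒≤ k<N)
    far : ℕ
    far = join q (-ᵣ (3 ℕ.+ c))
    turn : ℕ
    turn = join (suc q) (-ᵣ 2)
    to-N-3 : Walk k origin (x (X.at ((N ℕ.∸ 3) ℕ.+ q ℕ.* N))) 3
    to-N-3 = step (y-adj⁻ 0 (join 0 (-ᵣ 1)) ≋-refl)
            (step (adj-sym (y-adj⁺ turn (join 0 (-ᵣ 1))
                    (≋-trans (≋-drop-multiple (N ℕ.∸ 1) 0) (≋-sym (≋-drop-multiple (N ℕ.∸ 1) (suc q))))))
            (step (y-adj⁻ turn ((N ℕ.∸ 3) ℕ.+ q ℕ.* N) (≋-from-ℕ 1 0 (wrap-twice (N ℕ.∸ 2) N q))) here))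

  walk-x : ∀ q r → q < 4 → Reduced r → Walk k origin (x (X.at (join q r))) (distX (parity q) r)
  walk-x q 0ᵣ _ _ = step (enter q) (step (adj-sym (x-step-adj (q ℕ.* N))) here)
  walk-x q (+ᵣ suc c) _ _ =
    step (enter q) (subst (λ n → Walk k (x (X.at (suc (q ℕ.* N)))) (x (X.at n)) c) (ℕ.+-suc c (q ℕ.* N))
                          (x-forward (suc (q ℕ.* N)) c))
  walk-x q (-ᵣ 1) q<4 _ = walk-x-minus₁ q q<4
  walk-x q (-ᵣ 2) q<4 _ =
    subst (Walk k origin _) (sym (ℕ.+-suc (detour (parity q)) 1))
          (walk-x-minus₁ q q<4 ▷ adj-sym (x-step-adj (join q (-ᵣ 2))))
  walk-x q (-ᵣ suc (suc (suc c))) _ (_ , 3+c≤k) = walk-x-far q c 3+c≤k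

  private
    rotate : ∀ c n q → suc (suc c ℕ.+ (n ℕ.+ q ℕ.* n)) ≡ n ℕ.+ (suc (suc c) ℕ.+ q ℕ.* n)
    rotate = ℕ-Solver.solve-∀

  walk-y-far : ∀ q c → 3 ℕ.+ c ℕ.≤ k →
               Walk k origin (y (Y.at (join q (-ᵣ (3 ℕ.+ c))))) (suc (distX 0ℙ (-ᵣ (2 ℕ.+ c))))
  walk-y-far q c 3+c≤k = walk-x 0 (-ᵣ (2 ℕ.+ c)) (s≤s z≤n) (s≤s z≤n , ℕ.≤-trans (ℕ.n≤1+n _) 3+c≤k)
    ▷ adj-sym (y-adj⁺ (join q (-ᵣ (3 ℕ.+ c))) (join 0 (-ᵣ (2 ℕ.+ c)))
        (≋-trans (≋-drop-multiple (N ℕ.∸ (2 ℕ.+ c)) 0)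
          (≋-trans (≋-reflexive (cong +_ (N∸c≡1+N∸[1+c] (2 ℕ.+ c) (ℕ.≤-trans 3+c≤k (ℕ.<⇒≤ k<N)))))
            (≋-sym (≋-drop-multiple (suc (N ℕ.∸ (3 ℕ.+ c))) q)))))

  walk-y : ∀ q r → q < 2 → Reduced r → Walk k origin (y (Y.at (join q r))) (distY (parity q) r)
  walk-y 0 0ᵣ _ _ = here
  walk-y (suc (suc _)) 0ᵣ (s≤s (s≤s ())) _
  walk-y 1 0ᵣ _ _ = step (enter 0) (step (adj-sym (y-adj⁺ (join 1 0ᵣ) 1 (≋-sym (≋-drop-multiple 1 1)))) here)
  walk-y q (+ᵣ 1) _ _ =
    step (enter 0) (step (x-step-adj 1) (step (adj-sym (y-adj⁺ (join q (+ᵣ 1)) 2 (≋-sym (≋-drop-multiple 2 q)))) here))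
  walk-y q (+ᵣ suc (suc c)) (s≤s q≤1) (_ , c≤k) =
    walk-x (suc q) (+ᵣ suc c) (s≤s (s≤s (ℕ.≤-trans q≤1 (ℕ.n≤1+n 1)))) (s≤s z≤n , ℕ.≤-trans (ℕ.n≤1+n _) c≤k)
    ▷ adj-sym (y-adj⁻ (join q (+ᵣ suc (suc c))) (join (suc q) (+ᵣ suc c)) (≋-reflexive (cong +_ (rotate c N q))))
  walk-y q (-ᵣ 1) _ _ =
    step (enter 0) (step (adj-sym (x-step-adj 0))
      (step (adj-sym (y-adj⁺ (join q (-ᵣ 1)) 0 (≋-sym (≋-drop-multiple 0 (suc q))))) here))
  walk-y q (-ᵣ 2) _ _ = step (y-adj⁻ 0 (join 0 (-ᵣ 1)) ≋-refl)
    (step (adj-sym (y-adj⁺ (join q (-ᵣ 2)) (join 0 (-ᵣ 1))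
            (≋-trans (≋-drop-multiple (N ℕ.∸ 1) 0) (≋-sym (≋-drop-multiple (N ℕ.∸ 1) q))))) here)

  walk-y q (-ᵣ suc (suc (suc zero))) _ (_ , 3≤k) = walk-y-far q 0 3≤k
  walk-y q (-ᵣ suc (suc (suc (suc c)))) _ (_ , 4+c≤k) = walk-y-far q (suc c) 4+c≤k

  walk-to : ∀ p → Valid p → Walk k origin (vertex p) (profile p)
  walk-to (xᵖ q r) (q<4 , r↓) = walk-x q r q<4 r↓
  walk-to (yᵖ q r) (q<2 , r↓) = walk-y q r q<2 r↓

  position-j≡0 : Y.position j ≡ 0
  position-j≡0 = cong (_%ℕ Ly k) (ℤ.+-inverseʳ jℤ)

  origin≡yj : origin ≡ y j
  origin≡yj = cong y (trans (cong Y.at (sym position-j≡0)) (Y.at-position j))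

  walk-to-vertex : ∀ v → Walk k (y j) v (D v)
  walk-to-vertex v = subst₂ (λ s t → Walk k s t (D v)) origin≡yj (vertex-coord v) (walk-to (coord v) (coord-valid v))

  D-≤-length : ∀ {v n} → Walk k (y j) v n → D v ℕ.≤ n
  D-≤-length {v} {n} w = subst (λ d → D v ℕ.≤ d ℕ.+ n) (cong profileY position-j≡0) (D-≤-walk w)

  distance⇔D : ∀ v i → IsDist k (y j) v i ⇔ D v ≡ i
  distance⇔D v i = mk⇔ to from
    where
    to : IsDist k (y j) v i → D v ≡ i
    to (w , minimal) with D v ℕ.<? i
    ... | yes D<i = ⊥-elim (minimal (D v) D<i (walk-to-vertex v))
    ... | no D≮i = ℕ.≤-antisym (D-≤-length w) (ℕ.≮⇒≥ D≮i)
    from : D v ≡ i → IsDist k (y j) v i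
    from refl = walk-to-vertex v , λ m m<D w → ℕ.<⇒≱ m<D (D-≤-length w)


module Spheres (k-5 : ℕ) (j : Fin (Ly (Profile.k k-5))) where

  import Data.Nat as ℕ
  import Data.Nat.Properties as ℕ
  open import Data.Nat using (suc; _<_; z≤n; s≤s)
  open import Data.Integer using (_+_; _-_; _*_)
  open import Data.Integer.Tactic.RingSolver using (solve-∀)
  open import Data.Parity.Base using (0ℙ; 1ℙ)
  open import Data.Unit using (tt)
  open import Data.Product using (Σ; _×_; _,_; proj₁; proj₂)
  open import Data.Sum.Function.Propositional using (_⊎-⇔_)
  open import Data.List using ([]; _∷_; map; length)
  open import Data.List.Properties using (map-∘; map-id-local; length-map)
  open import Data.List.Relation.Unary.Any using (here; there)
  import Data.List.Relation.Unary.All as All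
  open import Data.List.Relation.Unary.Unique.Propositional using (Unique)
  import Data.List.Relation.Unary.Unique.Propositional.Properties as Unique
  open import Data.List.Membership.Propositional using (_∈_)
  open import Data.List.Membership.Propositional.Properties using (∈-map⁺; ∈-map⁻)
  open import Function.Bundles using (_⇔_; mk⇔; Equivalence)
  import Function.Properties.Equivalence as ⇔
  open import Level using (0ℓ)
  open import Relation.Binary.PropositionalEquality
  import Relation.Binary.Reasoning.Setoid
  open Congruence
  open Distance k-5 j public

  module ⇔-Reasoning = Relation.Binary.Reasoning.Setoid (⇔.⇔-setoid 0ℓ)

  x-coset⇔ : ∀ a r {z} → Reduced r → z ≡ (+ toℕ a - (jℤ - + 1)) - signed r →
             ⟨ + 2 * + k + + 1 ⟩[ Lx k ] z ⇔ rX a ≡ r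
  x-coset⇔ a r r↓ refl = begin
    ⟨ + 2 * + k + + 1 ⟩[ Lx k ] ((+ toℕ a - (jℤ - + 1)) - signed r)  ≈⟨ generated⇔≋0 4 (sym N-as-ℤ) Lx≡4N ⟩
    (+ toℕ a - (jℤ - + 1)) - signed r ≋ + 0 [mod N ]                  ≈⟨ ≋-zero⇔ ⟩
    + toℕ a - (jℤ - + 1) ≋ signed r [mod N ]                          ≈⟨ ≋-resp⇔ (modLx⇒modN (X.position-≋ a)) (value≋signed r r↓) ⟨
    + X.position a ≋ + value r [mod N ]                               ≈⟨ residue≡⇔ (X.position a) r r↓ ⟨
    rX a ≡ r                                                          ∎
    where open ⇔-Reasoning

  y-coset⇔ : ∀ b r {z} → Reduced r → z ≡ (+ toℕ b - jℤ) - signed r →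
             ⟨ + 2 * + k + + 1 ⟩[ Ly k ] z ⇔ rY b ≡ r
  y-coset⇔ b r r↓ refl = begin
    ⟨ + 2 * + k + + 1 ⟩[ Ly k ] ((+ toℕ b - jℤ) - signed r)  ≈⟨ generated⇔≋0 2 (sym N-as-ℤ) Ly≡2N ⟩
    (+ toℕ b - jℤ) - signed r ≋ + 0 [mod N ]                  ≈⟨ ≋-zero⇔ ⟩
    + toℕ b - jℤ ≋ signed r [mod N ]                          ≈⟨ ≋-resp⇔ (modLy⇒modN (Y.position-≋ b)) (value≋signed r r↓) ⟨
    + Y.position b ≋ + value r [mod N ]                       ≈⟨ residue≡⇔ (Y.position b) r r↓ ⟨
    rY b ≡ r                                                  ∎
    where open ⇔-Reasoning

  x-half-coset⇔ : ∀ a c {z} → Reduced (-ᵣ c) → z ≡ (+ toℕ a - (jℤ - + 1)) - - + c →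
                  ⟨ + 4 * + k + + 2 ⟩[ Lx k ] z ⇔ (rX a ≡ -ᵣ c × pX a ≡ 1ℙ)
  x-half-coset⇔ a c c↓@(_ , c≤k) refl = begin
    ⟨ + 4 * + k + + 2 ⟩[ Lx k ] ((+ toℕ a - (jℤ - + 1)) - - + c)  ≈⟨ generated⇔≋0 2 (sym 2N-as-ℤ) Lx≡2[2N] ⟩
    (+ toℕ a - (jℤ - + 1)) - - + c ≋ + 0 [mod 2 ℕ.* N ]           ≈⟨ ≋-zero⇔ ⟩
    + toℕ a - (jℤ - + 1) ≋ - + c [mod 2 ℕ.* N ]                   ≈⟨ ≋-resp⇔ (modLx⇒mod2N (X.position-≋ a)) (odd-minus≋ c c≤k) ⟨
    + X.position a ≋ + join 1 (-ᵣ c) [mod 2 ℕ.* N ]               ≈⟨ split-2N⇔ (X.position a) 1 (-ᵣ c) c↓ ⟩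
    (rX a ≡ -ᵣ c × pX a ≡ 1ℙ)                                      ∎
    where open ⇔-Reasoning

  x-pair⇔ : ∀ a → ⟦ (+ 2 * + k - + 2) ∷ (+ 6 * + k) ∷ [] ⟧[ Lx k ] (+ toℕ a - jℤ) ⇔
                  (rX a ≡ -ᵣ 2 × pX a ≡ 0ℙ)
  x-pair⇔ a = begin
    ⟦ (+ 2 * + k - + 2) ∷ (+ 6 * + k) ∷ [] ⟧[ Lx k ] w    ≈⟨ mk⇔ to from ⟩
    w ≋ + 2 * + k - + 2 [mod 2 ℕ.* N ]                    ≈⟨ ≋-+ʳ⇔ (+ 1) ⟩
    w + + 1 ≋ (+ 2 * + k - + 2) + + 1 [mod 2 ℕ.* N ]      ≈⟨ ≋-resp⇔ position≋w+1 (≋-reflexive minus-two) ⟨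
    + X.position a ≋ + join 0 (-ᵣ 2) [mod 2 ℕ.* N ]       ≈⟨ split-2N⇔ (X.position a) 0 (-ᵣ 2) (s≤s z≤n , s≤s (s≤s z≤n)) ⟩
    (rX a ≡ -ᵣ 2 × pX a ≡ 0ℙ)                              ∎
    where
    open ⇔-Reasoning
    w = + toℕ a - jℤ
    minus-two : + join 0 (-ᵣ 2) ≡ (+ 2 * + k - + 2) + + 1
    minus-two = trans (cong +_ (ℕ.+-identityʳ (N ℕ.∸ 2))) (trans N∸2-as-ℤ (trans (cong (_- + 2) N-as-ℤ) (regroup (+ k))))
      where
      regroup : ∀ K → (+ 2 * K + + 1) - + 2 ≡ (+ 2 * K - + 2) + + 1
      regroup = solve-∀
    shift-origin : ∀ a j → a - (j - + 1) ≡ (a - j) + + 1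
    shift-origin = solve-∀
    position≋w+1 : + X.position a ≋ w + + 1 [mod 2 ℕ.* N ]
    position≋w+1 = ≋-trans (modLx⇒mod2N (X.position-≋ a)) (≋-reflexive (shift-origin (+ toℕ a) jℤ))
    wrap : ∀ K → + 6 * K ≡ (+ 2 * K - + 2) + + 1 * (+ 4 * K + + 2)
    wrap = solve-∀
    no-turn : ∀ b n → b + + 0 * n ≡ b
    no-turn = solve-∀
    one-turn : (+ 2 * + k - + 2) + + 1 * + (2 ℕ.* N) ≡ + 6 * + k
    one-turn = trans (cong (λ n → (+ 2 * + k - + 2) + + 1 * n) 2N-as-ℤ) (sym (wrap (+ k)))
    to : ⟦ (+ 2 * + k - + 2) ∷ (+ 6 * + k) ∷ [] ⟧[ Lx k ] w → w ≋ + 2 * + k - + 2 [mod 2 ℕ.* N ]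
    to (here w≡) = modLx⇒mod2N (≡⇒≋ {Lx k} {w} w≡)
    to (there (here w≡)) = ≋-drop (+ 1) (subst (λ t → w ≋ t [mod 2 ℕ.* N ]) (sym one-turn) (modLx⇒mod2N (≡⇒≋ {Lx k} {w} w≡)))
    from : w ≋ + 2 * + k - + 2 [mod 2 ℕ.* N ] → ⟦ (+ 2 * + k - + 2) ∷ (+ 6 * + k) ∷ [] ⟧[ Lx k ] w
    from w≋ = lifted (≋-lift 2 w≋)
      where
      lifted : Σ ℕ (λ r → r < 2 × w ≋ (+ 2 * + k - + 2) + + r * + (2 ℕ.* N) [mod 2 ℕ.* (2 ℕ.* N) ]) →
               ⟦ (+ 2 * + k - + 2) ∷ (+ 6 * + k) ∷ [] ⟧[ Lx k ] w
      lifted (0 , _ , w≋′) =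
        here (≋⇒≡ (subst₂ (λ L t → w ≋ t [mod L ]) (sym Lx≡2[2N]) (no-turn (+ 2 * + k - + 2) (+ (2 ℕ.* N))) w≋′))
      lifted (1 , _ , w≋′) = there (here (≋⇒≡ (subst₂ (λ L t → w ≋ t [mod L ]) (sym Lx≡2[2N]) one-turn w≋′)))
      lifted (suc (suc _) , s≤s (s≤s ()) , _)

  y-single⇔ : ∀ b → ⟦ (jℤ + (+ 2 * + k + + 1)) ∷ [] ⟧[ Ly k ] (+ toℕ b) ⇔ (rY b ≡ 0ᵣ × pY b ≡ 1ℙ)
  y-single⇔ b = begin
    ⟦ (jℤ + (+ 2 * + k + + 1)) ∷ [] ⟧[ Ly k ] (+ toℕ b)   ≈⟨ mk⇔ to from ⟩
    + toℕ b ≋ jℤ + + N [mod 2 ℕ.* N ]                     ≈⟨ ≋-+ʳ⇔ (- jℤ) ⟩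
    + toℕ b - jℤ ≋ (jℤ + + N) - jℤ [mod 2 ℕ.* N ]         ≈⟨ ≋-resp⇔ (modLy⇒mod2N (Y.position-≋ b)) (≋-reflexive half-turn) ⟨
    + Y.position b ≋ + join 1 0ᵣ [mod 2 ℕ.* N ]           ≈⟨ split-2N⇔ (Y.position b) 1 0ᵣ tt ⟩
    (rY b ≡ 0ᵣ × pY b ≡ 1ℙ)                               ∎
    where
    open ⇔-Reasoning
    half-turn : + join 1 0ᵣ ≡ (jℤ + + N) - jℤ
    half-turn = trans (cong +_ (ℕ.*-identityˡ N)) (cancel jℤ (+ N))
      where
      cancel : ∀ j n → n ≡ (j + n) - j
      cancel = solve-∀
    target : jℤ + (+ 2 * + k + + 1) ≡ jℤ + + N
    target = cong (_+_ jℤ) (sym N-as-ℤ)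
    to : ⟦ (jℤ + (+ 2 * + k + + 1)) ∷ [] ⟧[ Ly k ] (+ toℕ b) → + toℕ b ≋ jℤ + + N [mod 2 ℕ.* N ]
    to (here b≡) = subst (λ t → + toℕ b ≋ t [mod 2 ℕ.* N ]) target (modLy⇒mod2N (≡⇒≋ {Ly k} {+ toℕ b} b≡))
    from : + toℕ b ≋ jℤ + + N [mod 2 ℕ.* N ] → ⟦ (jℤ + (+ 2 * + k + + 1)) ∷ [] ⟧[ Ly k ] (+ toℕ b)
    from b≋ = here (≋⇒≡ (subst₂ (λ L t → + toℕ b ≋ t [mod L ]) (sym Ly≡2N) (sym target) b≋))

  sphere⇔ : ∀ i {A B : ZSet} → (∀ a → distX (pX a) (rX a) ≡ i ⇔ A (+ toℕ a)) →
            (∀ b → distY (pY b) (rY b) ≡ i ⇔ B (+ toℕ b)) → S k i (y j) ≐ ⟪ A & B ⟫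
  sphere⇔ i onX onY (x a) = ⇔.trans (distance⇔D (x a) i) (onX a)
  sphere⇔ i onX onY (y b) = ⇔.trans (distance⇔D (y b) i) (onY b)

  private
    reorder : ∀ a c o → (a - c) - o ≡ (a - o) - c
    reorder = solve-∀
    reorder₁ : ∀ a o → (a - + 1) - o ≡ (a - (o - + 1)) - + 2
    reorder₁ = solve-∀
    reorder₀ : ∀ a o → (a - - + 1) - o ≡ (a - (o - + 1)) - + 0
    reorder₀ = solve-∀
    reorder-odd : ∀ a o c → (a - - (c + + 1)) - o ≡ (a - (o - + 1)) - - c
    reorder-odd = solve-∀

    x± : ∀ a r → Reduced r → ⟨ + 2 * + k + + 1 ⟩[ Lx k ] ((+ toℕ a - signed r) - (jℤ - + 1)) ⇔ rX a ≡ r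
    x± a r r↓ = x-coset⇔ a r r↓ (reorder (+ toℕ a) (signed r) (jℤ - + 1))

    y± : ∀ b r → Reduced r → ⟨ + 2 * + k + + 1 ⟩[ Ly k ] ((+ toℕ b - signed r) - jℤ) ⇔ rY b ≡ r
    y± b r r↓ = y-coset⇔ b r r↓ (reorder (+ toℕ b) (signed r) jℤ)

    x-odd : ∀ a c → Reduced (-ᵣ c) →
            ⟨ + 4 * + k + + 2 ⟩[ Lx k ] ((+ toℕ a - - (+ c + + 1)) - jℤ) ⇔ (rX a ≡ -ᵣ c × pX a ≡ 1ℙ)
    x-odd a c c↓ = x-half-coset⇔ a c c↓ (reorder-odd (+ toℕ a) jℤ (+ c))

  sphere-2 : S k 2 (y j) ≐ ⟪ (± + 1 +ₛ ((+ toℕ j) +ₛ ⟨ + 2 * + k + + 1 ⟩[ Lx k ]))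
                               ∪ ((+ toℕ j) +ₛ ⟦ (+ 2 * + k - + 2) ∷ (+ 6 * + k) ∷ [] ⟧[ Lx k ])
                             & (± + 2 +ₛ ((+ toℕ j) +ₛ ⟨ + 2 * + k + + 1 ⟩[ Ly k ]))
                               ∪ ⟦ (+ toℕ j + (+ 2 * + k + + 1)) ∷ [] ⟧[ Ly k ] ⟫
  sphere-2 = sphere⇔ 2
    (λ a → ⇔.trans (distX≡2⇔ (pX a) (rX a)) (⇔.sym
      ((x-coset⇔ a (+ᵣ 2) 2↓ (reorder₁ (+ toℕ a) jℤ) ⊎-⇔ x-coset⇔ a 0ᵣ tt (reorder₀ (+ toℕ a) jℤ)) ⊎-⇔ x-pair⇔ a)))
    (λ b → ⇔.trans (distY≡2⇔ (pY b) (rY b)) (⇔.sym ((y± b (+ᵣ 2) 2↓ ⊎-⇔ y± b (-ᵣ 2) 2↓) ⊎-⇔ y-single⇔ b)))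
    where
    2↓ : 1 ℕ.≤ 2 × 2 ℕ.≤ k
    2↓ = s≤s z≤n , ℕ.m≤m+n 2 _

  sphere-3 : S k 3 (y j) ≐ ⟪ (± + 3 +ₛ ((+ toℕ j - + 1) +ₛ ⟨ + 2 * + k + + 1 ⟩[ Lx k ]))
                               ∪ ((- + 2) +ₛ ((+ toℕ j) +ₛ ⟨ + 4 * + k + + 2 ⟩[ Lx k ]))
                             & (± + 3 +ₛ ((+ toℕ j) +ₛ ⟨ + 2 * + k + + 1 ⟩[ Ly k ]))
                               ∪ (± + 1 +ₛ ((+ toℕ j) +ₛ ⟨ + 2 * + k + + 1 ⟩[ Ly k ])) ⟫
  sphere-3 = sphere⇔ 3
    (λ a → ⇔.trans (distX≡3⇔ (pX a) (rX a)) (⇔.sym ((x± a (+ᵣ 3) 3↓ ⊎-⇔ x± a (-ᵣ 3) 3↓) ⊎-⇔ x-odd a 1 1↓)))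
    (λ b → ⇔.trans (distY≡3⇔ (pY b) (rY b)) (⇔.sym
      ((y± b (+ᵣ 3) 3↓ ⊎-⇔ y± b (-ᵣ 3) 3↓) ⊎-⇔ (y± b (+ᵣ 1) 1↓ ⊎-⇔ y± b (-ᵣ 1) 1↓))))
    where
    1↓ : 1 ℕ.≤ 1 × 1 ℕ.≤ k
    1↓ = s≤s z≤n , ℕ.m≤m+n 1 _
    3↓ : 1 ℕ.≤ 3 × 3 ℕ.≤ k
    3↓ = s≤s z≤n , ℕ.m≤m+n 3 _

  sphere-4 : S k 4 (y j) ≐ ⟪ (± + 4 +ₛ ((+ toℕ j - + 1) +ₛ ⟨ + 2 * + k + + 1 ⟩[ Lx k ]))
                               ∪ ((- + 3) +ₛ ((+ toℕ j) +ₛ ⟨ + 4 * + k + + 2 ⟩[ Lx k ]))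
                             & ± + 4 +ₛ ((+ toℕ j) +ₛ ⟨ + 2 * + k + + 1 ⟩[ Ly k ]) ⟫
  sphere-4 = sphere⇔ 4
    (λ a → ⇔.trans (distX≡4⇔ (pX a) (rX a)) (⇔.sym ((x± a (+ᵣ 4) 4↓ ⊎-⇔ x± a (-ᵣ 4) 4↓) ⊎-⇔ x-odd a 2 2↓)))
    (λ b → ⇔.trans (distY≡far⇔ (pY b) (rY b) 0) (⇔.sym (y± b (+ᵣ 4) 4↓ ⊎-⇔ y± b (-ᵣ 4) 4↓)))
    where
    2↓ : 1 ℕ.≤ 2 × 2 ℕ.≤ k
    2↓ = s≤s z≤n , ℕ.m≤m+n 2 _
    4↓ : 1 ℕ.≤ 4 × 4 ℕ.≤ k
    4↓ = s≤s z≤n , ℕ.m≤m+n 4 _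

  sphere-far : ∀ i → 5 ℕ.≤ i → i ℕ.≤ k →
               S k i (y j) ≐ ⟪ ± + i +ₛ ((+ toℕ j - + 1) +ₛ ⟨ + 2 * + k + + 1 ⟩[ Lx k ])
                             & ± + i +ₛ ((+ toℕ j) +ₛ ⟨ + 2 * + k + + 1 ⟩[ Ly k ]) ⟫
  sphere-far i@(suc (suc (suc (suc (suc m))))) (s≤s (s≤s (s≤s (s≤s (s≤s _))))) i≤k = sphere⇔ i
    (λ a → ⇔.trans (distX≡far⇔ (pX a) (rX a) m) (⇔.sym (x± a (+ᵣ i) i↓ ⊎-⇔ x± a (-ᵣ i) i↓)))
    (λ b → ⇔.trans (distY≡far⇔ (pY b) (rY b) (suc m)) (⇔.sym (y± b (+ᵣ i) i↓ ⊎-⇔ y± b (-ᵣ i) i↓)))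
    where
    i↓ : 1 ℕ.≤ i × i ℕ.≤ k
    i↓ = s≤s z≤n , i≤k

  D-vertex : ∀ p → Valid p → D (vertex p) ≡ profile p
  D-vertex p p✓ = cong profile (coord-vertex p p✓)

  sphere-card : ∀ i → i ℕ.≤ k → Unique (level i) → HasCard (S k i (y j)) (length (level i))
  sphere-card i i≤k level-unique =
    map vertex (level i) , vertices-unique , length-map vertex (level i) , λ v → mk⇔ (to v) (from v)
    where
    members : ∀ {p} → p ∈ level i → Valid p × profile p ≡ i
    members {p} = Equivalence.to (∈-level⇔ i p i≤k)
    coords-of-vertices : map coord (map vertex (level i)) ≡ level i
    coords-of-vertices =
      trans (sym (map-∘ (level i))) (map-id-local (All.tabulate (λ p∈ → coord-vertex _ (proj₁ (members p∈)))))
    vertices-unique : Unique (map vertex (level i))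
    vertices-unique = Unique.map⁻ (subst Unique (sym coords-of-vertices) level-unique)
    to : ∀ v → v ∈ map vertex (level i) → S k i (y j) v
    to v v∈ with ∈-map⁻ vertex v∈
    ... | p , p∈ , refl =
      Equivalence.from (distance⇔D (vertex p) i) (trans (D-vertex p (proj₁ (members p∈))) (proj₂ (members p∈)))
    from : ∀ v → S k i (y j) v → v ∈ map vertex (level i)
    from v v∈S = subst (_∈ map vertex (level i)) (vertex-coord v)
      (∈-map⁺ vertex (Equivalence.from (∈-level⇔ i (coord v) i≤k) (coord-valid v , Equivalence.to (distance⇔D v i) v∈S)))

  eccentricity : Ecc k (y j) k
  eccentricity =
    (λ v → D v , profile≤k (coord v) (coord-valid v) , Equivalence.from (distance⇔D v (D v)) refl) ,
    vertex farthest , Equivalence.from (distance⇔D (vertex farthest) k) (D-vertex farthest (s≤s z≤n , s≤s z≤n , ℕ.≤-refl))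
    where
    farthest : Point
    farthest = xᵖ 0 (+ᵣ k)

open import Data.Nat using (s≤s)
open import Data.Nat.Properties using (m≤m+n)
open import Data.Integer using (_+_; _-_; _*_)
open import Data.List using (List; []; _∷_)
open import Data.Product using (_,_)

lemma3p13 : (k : ℕ) → 5 ≤ k → (j : Fin (Ly k)) →
    -- (i)
    (S k 2 (y j) ≐ ⟪ (± + 1 +ₛ ((+ toℕ j) +ₛ ⟨ + 2 * + k + + 1 ⟩[ Lx k ]))
                       ∪ ((+ toℕ j) +ₛ ⟦ (+ 2 * + k - + 2) ∷ (+ 6 * + k) ∷ [] ⟧[ Lx k ])
                   & (± + 2 +ₛ ((+ toℕ j) +ₛ ⟨ + 2 * + k + + 1 ⟩[ Ly k ]))
                       ∪ ⟦ (+ toℕ j + (+ 2 * + k + + 1)) ∷ [] ⟧[ Ly k ] ⟫)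
    -- (ii)
    × (S k 3 (y j) ≐ ⟪ (± + 3 +ₛ ((+ toℕ j - + 1) +ₛ ⟨ + 2 * + k + + 1 ⟩[ Lx k ]))
                       ∪ ((- + 2) +ₛ ((+ toℕ j) +ₛ ⟨ + 4 * + k + + 2 ⟩[ Lx k ]))
                     & (± + 3 +ₛ ((+ toℕ j) +ₛ ⟨ + 2 * + k + + 1 ⟩[ Ly k ]))
                       ∪ (± + 1 +ₛ ((+ toℕ j) +ₛ ⟨ + 2 * + k + + 1 ⟩[ Ly k ])) ⟫)
    -- (iii)
    × (S k 4 (y j) ≐ ⟪ (± + 4 +ₛ ((+ toℕ j - + 1) +ₛ ⟨ + 2 * + k + + 1 ⟩[ Lx k ]))
                       ∪ ((- + 3) +ₛ ((+ toℕ j) +ₛ ⟨ + 4 * + k + + 2 ⟩[ Lx k ]))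
                     & ± + 4 +ₛ ((+ toℕ j) +ₛ ⟨ + 2 * + k + + 1 ⟩[ Ly k ]) ⟫)
    -- (iv)
    × (∀ i → 5 ≤ i → i ≤ k →
         S k i (y j) ≐ ⟪ ± + i +ₛ ((+ toℕ j - + 1) +ₛ ⟨ + 2 * + k + + 1 ⟩[ Lx k ])
                       & ± + i +ₛ ((+ toℕ j) +ₛ ⟨ + 2 * + k + + 1 ⟩[ Ly k ]) ⟫)
    -- (v)
    × HasCard (S k 2 (y j)) 15 × HasCard (S k 3 (y j)) 18 × HasCard (S k 4 (y j)) 14
    × (∀ i → 5 ≤ i → i ≤ k → HasCard (S k i (y j)) 12)
    × Ecc k (y j) k
lemma3p13 (suc (suc (suc (suc (suc k-5))))) (s≤s (s≤s (s≤s (s≤s (s≤s _))))) j =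
  sphere-2 , sphere-3 , sphere-4 , sphere-far ,
  sphere-card 2 (m≤m+n 2 _) (level-unique 2) ,
  sphere-card 3 (m≤m+n 3 _) (level-unique 3) ,
  sphere-card 4 (m≤m+n 4 _) (level-unique 4) ,
  far-card , eccentricity
  where
  open Spheres k-5 j
  far-card : ∀ i → 5 ≤ i → i ≤ k → HasCard (S k i (y j)) 12
  far-card i@(suc (suc (suc (suc (suc _))))) (s≤s (s≤s (s≤s (s≤s (s≤s _))))) i≤k =
    sphere-card i i≤k (level-unique i)
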